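{- Let $G$ be a finite, connected, undirected multigraph without loops with $n$ vertices, reduced Laplacian $\tilde L$, $m=|\mathrm{Jac}(G)|$ and $C^{\tilde L}=m\tilde L^{ -1}$. Let $D\in\mathrm{Div}^0(G)$ and let $\tilde w\in\mathbb{Z}^{n-1}$ be the vector $C^{\tilde L}\tilde D$ with each entry reduced to lie in $\{0,1,\dots,m-1\}$. Let $\phi:\mathrm{Div}^0(G)\to\mathbb{Z}/m\mathbb{Z}$ be the map $D'\mapsto \tilde w\cdot\tilde D'\pmod m$. Then the order of $[D]$ in $\mathrm{Jac}(G)$ equals $|\mathrm{Im}(\phi)|$, which equals $m/\gcd(m,\tilde w)$, where $\gcd(m,\tilde w)$ is the greatest common divisor of $m$ and all the entries of $\tilde w$.
   Context: Vertices are indexed $v_1,\dots,v_n$. A divisor is a vector in $\mathbb{Z}^n$; $\mathrm{Div}^0(G)$ is the group of divisors with entry sum $0$; $\tilde D$ is $D$ with its $n$-th entry deleted. The Laplacian is $L=\Delta-A$ ($\Delta$ diagonal of valencies, $A_{ij}$ the number of edges between $v_i,v_j$); $\tilde L$ is $L$ with the $n$-th row and column deleted, with $\det\tilde L=m$, so $C^{\tilde L}$ is an integer matrix (the cofactor matrix of $\tilde L$). $\mathrm{Jac}(G)=\mathrm{Div}^0(G)/\{L\sigma:\sigma\in\mathbb{Z}^n\}$. -}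

module Defs where

open import Data.Nat as ℕ using (ℕ; zero; suc)
open import Data.Nat.GCD using (gcd)
import Data.Nat.DivMod as NDM
open import Data.Integer as ℤ using (ℤ; +_; _%ℕ_)
open import Data.Fin using (Fin; zero; suc; toℕ; inject₁; fromℕ; punchIn)
open import Data.List using (List; length)
open import Data.List.Membership.Propositional using (_∈_)
open import Data.List.Relation.Unary.Unique.Propositional using (Unique)
open import Data.Product using (Σ; ∃; _×_; _,_)
open import Relation.Binary.PropositionalEquality using (_≡_)
open import Function.Bundles using (_⇔_)

Σℤ : ∀ k → (Fin k → ℤ) → ℤ
Σℤ zero    f = + 0
Σℤ (suc k) f = f zero ℤ.+ Σℤ k (λ i → f (suc i))

Matrix : ℕ → Set
Matrix k = Fin k → Fin k → ℤ

sgn : ℕ → ℤ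
sgn zero          = + 1
sgn (suc zero)    = ℤ.- (+ 1)
sgn (suc (suc e)) = sgn e

minor : ∀ {k} → Fin (suc k) → Fin (suc k) → Matrix (suc k) → Matrix k
minor i j M a b = M (punchIn i a) (punchIn j b)

det : ∀ k → Matrix k → ℤ
det zero    M = + 1
det (suc k) M = Σℤ (suc k) (λ j → sgn (toℕ j) ℤ.* (M zero j ℤ.* det k (minor zero j M)))

adj : ∀ k → Matrix k → Matrix k
adj zero    M () j
adj (suc k) M i j = sgn (toℕ i ℕ.+ toℕ j) ℤ.* det k (minor j i M)

_·ᵥ_ : ∀ {k} → Matrix k → (Fin k → ℤ) → Fin k → ℤ
_·ᵥ_ {k} M v i = Σℤ k (λ j → M i j ℤ.* v j)

-- Multigraphs on n = suc k vertices v₁,…,vₙ (vₙ is 'fromℕ k'),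
-- given by their adjacency matrix A (A i j = number of edges i–j).

Adj : ℕ → Set
Adj n = Fin n → Fin n → ℕ

data Reachable {n} (A : Adj n) : Fin n → Fin n → Set where
  here : ∀ {i} → Reachable A i i
  step : ∀ {i j l} → 0 ℕ.< A i j → Reachable A j l → Reachable A i l

record IsConnectedLooplessMultigraph {n} (A : Adj n) : Set where
  field
    symmetric : ∀ i j → A i j ≡ A j i
    loopless  : ∀ i → A i i ≡ 0
    connected : ∀ i j → Reachable A i j

valency : ∀ {n} → Adj n → Fin n → ℕ
valency {n} A i = ℤ.∣ Σℤ n (λ j → + A i j) ∣

δ : ∀ {n} → Fin n → Fin n → ℤ
δ zero    zero    = + 1
δ zero    (suc j) = + 0
δ (suc i) zero    = + 0
δ (suc i) (suc j) = δ i j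

laplacian : ∀ {n} → Adj n → Matrix n
laplacian A i j = (δ i j ℤ.* + valency A i) ℤ.- + A i j

reducedLaplacian : ∀ {k} → Adj (suc k) → Matrix k
reducedLaplacian A a b = laplacian A (inject₁ a) (inject₁ b)

-- m = det L̃ (= |Jac(G)|)
jacOrder : ∀ {k} → Adj (suc k) → ℕ
jacOrder {k} A = ℤ.∣ det k (reducedLaplacian A) ∣

-- C^{L̃}, the cofactor matrix (adjugate) of L̃, so C^{L̃} = m L̃⁻¹
cofactorL : ∀ {k} → Adj (suc k) → Matrix k
cofactorL {k} A = adj k (reducedLaplacian A)

Divisor : ℕ → Set
Divisor n = Fin n → ℤ

IsDeg0 : ∀ {n} → Divisor n → Set
IsDeg0 {n} D = Σℤ n D ≡ + 0

reduce~ : ∀ {k} → Divisor (suc k) → Fin k → ℤ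
reduce~ D a = D (inject₁ a)

IsPrincipal : ∀ {n} → Adj n → Divisor n → Set
IsPrincipal {n} A D = ∃ λ (σ : Fin n → ℤ) → ∀ i → D i ≡ (laplacian A ·ᵥ σ) i

_•_ : ∀ {n} → ℕ → Divisor n → Divisor n
(o • D) i = + o ℤ.* D i

-- o is the order of [D] in Jac(G) = Div⁰(G)/{Lσ}
IsOrderInJac : ∀ {n} → Adj n → Divisor n → ℕ → Set
IsOrderInJac A D o =
  (0 ℕ.< o) × IsPrincipal A (o • D) ×
  (∀ o' → 0 ℕ.< o' → IsPrincipal A (o' • D) → o ℕ.≤ o')

-- Reduction mod m into {0,…,m-1}  (m = 0 never occurs; junk value 0)

_modN_ : ℤ → ℕ → ℕ
x modN zero    = 0
x modN (suc m) = x %ℕ suc m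

wVec : ∀ {k} → Adj (suc k) → Divisor (suc k) → Fin k → ℕ
wVec A D a = ((cofactorL A ·ᵥ reduce~ D) a) modN jacOrder A

-- φ(D') = w̃ · D̃' mod m, as an element of {0,…,m-1} ≅ ℤ/mℤ
phi : ∀ {k} → Adj (suc k) → Divisor (suc k) → Divisor (suc k) → ℕ
phi {k} A D D' = Σℤ k (λ a → + wVec A D a ℤ.* reduce~ D' a) modN jacOrder A

InImagePhi : ∀ {k} → Adj (suc k) → Divisor (suc k) → ℕ → Set
InImagePhi A D r = ∃ λ D' → IsDeg0 D' × phi A D D' ≡ r

ImageCard : ∀ {k} → Adj (suc k) → Divisor (suc k) → ℕ → Set
ImageCard A D c = ∃ λ (xs : List ℕ) →
  Unique xs × (∀ r → (r ∈ xs) ⇔ InImagePhi A D r) × length xs ≡ c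

gcdFold : ∀ k → ℕ → (Fin k → ℕ) → ℕ
gcdFold zero    g w = g
gcdFold (suc k) g w = gcdFold k (gcd g (w zero)) (λ a → w (suc a))

gcdMW : ∀ {k} → Adj (suc k) → Divisor (suc k) → ℕ
gcdMW {k} A D = gcdFold k (jacOrder A) (wVec A D)

-- natural division (divisor 0 never occurs; junk value 0)
_divN_ : ℕ → ℕ → ℕ
a divN zero    = 0
a divN (suc b) = a NDM./ suc b

-- The reduced Laplacian L̃ of a connected graph is a symmetric, weakly chained diagonally
-- dominant Z-matrix: a maximum principle shows that it has trivial kernel, hence det L̃ ≠ 0 and
-- adj L̃ inverts L̃ on both sides up to the factor det L̃. A degree-0 divisor E is principal iff
-- L̃ τ = Ẽ has an integer solution, i.e. iff det L̃ divides every entry of adj L̃ · Ẽ. For E = o D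
-- this says m ∣ o w̃_b for every b, which by Bézout is m ∣ o gcd(m, w̃), i.e. m / gcd(m, w̃) ∣ o.
-- Every vector in ℤ^(n-1) is the reduction of a degree-0 divisor, so the values of φ are the
-- residues mod m of the integer combinations of w̃, which are the multiples of gcd(m, w̃) below m.

module Submission where

open import Defs
open import Data.Nat as ℕ using (ℕ; zero; suc)
import Data.Nat.Properties as ℕP
import Data.Nat.Divisibility as ℕ∣
open import Data.Nat.DivMod using (m*n/n≡m)
open import Data.Nat.GCD using (gcd; gcd[m,n]∣m; gcd[m,n]∣n; gcd-GCD; module Bézout)
open import Data.Integer as ℤ using (ℤ; +_; _+_; _*_; -_; _-_; _≤_; _<_; _⊖_; _%ℕ_; _/ℕ_)
import Data.Integer.Properties as ℤP
open import Data.Integer.DivMod using (a≡a%ℕn+[a/ℕn]*n; n%ℕd<d)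
open import Data.Integer.Divisibility.Signed
  using (_∣_; divides; ∣-refl; ∣-trans; ∣m∣n⇒∣m+n; ∣m+n∣n⇒∣m; ∣n⇒∣m*n; ∣m⇒∣m*n;
         *-monoʳ-∣; *-monoˡ-∣; *-cancelʳ-∣; ∣ᵤ⇒∣; ∣⇒∣ᵤ; ∣m∣∣m; m∣∣m∣)
open import Data.Integer.Tactic.RingSolver using (solve-∀)
open import Data.Fin as Fin using (Fin; zero; suc; toℕ; inject₁; fromℕ; punchIn; punchOut)
import Data.Fin.Properties as FinP
open import Data.Vec.Functional using (updateAt; insertAt)
open import Data.Vec.Functional.Properties
  using (updateAt-updates; updateAt-minimal; updateAt-id-local; insertAt-lookup; insertAt-punchIn)
open import Data.List using (List; map; upTo; length)
open import Data.List.Properties using (length-map; length-upTo)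
open import Data.List.Membership.Propositional using (_∈_)
open import Data.List.Membership.Propositional.Properties using (∈-map⁺; ∈-map⁻; ∈-upTo⁺; ∈-upTo⁻)
open import Data.List.Relation.Unary.Unique.Propositional using (Unique)
import Data.List.Relation.Unary.Unique.Propositional.Properties as Unique
open import Data.Product using (∃; ∃₂; _×_; _,_; proj₁; proj₂)
open import Data.Sum using (inj₁; inj₂)
open import Data.Empty using (⊥-elim)
open import Function.Base using (_∘_; flip)
open import Function.Bundles using (_⇔_; mk⇔; Equivalence)
open import Function.Construct.Symmetry using (⇔-sym)
open import Function.Properties.Equivalence using (⇔-setoid)
open import Algebra.Properties.Semiring.Sum ℤP.+-*-semiring
  using (sum; sum-cong-≗; ∑-comm; ∑-distrib-+; *-distribˡ-sum; sum-init-last; sum-remove)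
open import Algebra.Properties.AbelianGroup ℤP.+-0-abelianGroup using (∙-cancelˡ)
open import Level using (0ℓ)
open import Relation.Nullary using (yes; no)
open import Relation.Binary.PropositionalEquality
import Relation.Binary.Reasoning.Setoid

-- Finite sums

Σℤ≡sum : ∀ k (f : Fin k → ℤ) → Σℤ k f ≡ sum f
Σℤ≡sum zero    f = refl
Σℤ≡sum (suc k) f = cong (λ s → f zero + s) (Σℤ≡sum k (f ∘ suc))

Σℤ-cong : ∀ k {f g : Fin k → ℤ} → f ≗ g → Σℤ k f ≡ Σℤ k g
Σℤ-cong zero    f≗g = refl
Σℤ-cong (suc k) f≗g = cong₂ _+_ (f≗g zero) (Σℤ-cong k (f≗g ∘ suc))

Σℤ-zero : ∀ k {f : Fin k → ℤ} → (∀ i → f i ≡ + 0) → Σℤ k f ≡ + 0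
Σℤ-zero zero    f≡0 = refl
Σℤ-zero (suc k) f≡0 = cong₂ _+_ (f≡0 zero) (Σℤ-zero k (f≡0 ∘ suc))

Σℤ-distrib-+ : ∀ k (f g : Fin k → ℤ) → Σℤ k (λ i → f i + g i) ≡ Σℤ k f + Σℤ k g
Σℤ-distrib-+ k f g = begin
  Σℤ k (λ i → f i + g i) ≡⟨ Σℤ≡sum k _ ⟩
  sum (λ i → f i + g i)  ≡⟨ ∑-distrib-+ f g ⟩
  sum f + sum g          ≡⟨ cong₂ _+_ (Σℤ≡sum k f) (Σℤ≡sum k g) ⟨
  Σℤ k f + Σℤ k g        ∎
  where open ≡-Reasoning

*-distribˡ-Σℤ : ∀ k c (f : Fin k → ℤ) → c * Σℤ k f ≡ Σℤ k (λ i → c * f i)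
*-distribˡ-Σℤ k c f = begin
  c * Σℤ k f            ≡⟨ cong (c *_) (Σℤ≡sum k f) ⟩
  c * sum f             ≡⟨ *-distribˡ-sum c f ⟩
  sum (λ i → c * f i)   ≡⟨ Σℤ≡sum k _ ⟨
  Σℤ k (λ i → c * f i)  ∎
  where open ≡-Reasoning

*-distribʳ-Σℤ : ∀ k c (f : Fin k → ℤ) → Σℤ k f * c ≡ Σℤ k (λ i → f i * c)
*-distribʳ-Σℤ k c f = begin
  Σℤ k f * c             ≡⟨ ℤP.*-comm (Σℤ k f) c ⟩
  c * Σℤ k f             ≡⟨ *-distribˡ-Σℤ k c f ⟩
  Σℤ k (λ i → c * f i)   ≡⟨ Σℤ-cong k (λ i → ℤP.*-comm c (f i)) ⟩
  Σℤ k (λ i → f i * c)   ∎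
  where open ≡-Reasoning

Σℤ-comm : ∀ k l (f : Fin k → Fin l → ℤ) →
  Σℤ k (λ i → Σℤ l (f i)) ≡ Σℤ l (λ j → Σℤ k (λ i → f i j))
Σℤ-comm k l f = begin
  Σℤ k (λ i → Σℤ l (f i))           ≡⟨ Σℤ≡sum₂ k l f ⟩
  sum (λ i → sum (f i))             ≡⟨ ∑-comm f ⟩
  sum (λ j → sum (λ i → f i j))     ≡⟨ Σℤ≡sum₂ l k (flip f) ⟨
  Σℤ l (λ j → Σℤ k (λ i → f i j))   ∎
  where
  open ≡-Reasoning
  Σℤ≡sum₂ : ∀ k l (f : Fin k → Fin l → ℤ) → Σℤ k (λ i → Σℤ l (f i)) ≡ sum (λ i → sum (f i))
  Σℤ≡sum₂ k l f = trans (Σℤ≡sum k _) (sum-cong-≗ (λ i → Σℤ≡sum l (f i)))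

Σℤ-remove : ∀ k (f : Fin (suc k) → ℤ) i → Σℤ (suc k) f ≡ f i + Σℤ k (f ∘ punchIn i)
Σℤ-remove k f i = begin
  Σℤ (suc k) f                ≡⟨ Σℤ≡sum (suc k) f ⟩
  sum f                       ≡⟨ sum-remove f ⟩
  f i + sum (f ∘ punchIn i)   ≡⟨ cong (λ s → f i + s) (Σℤ≡sum k _) ⟨
  f i + Σℤ k (f ∘ punchIn i)  ∎
  where open ≡-Reasoning

Σℤ-init-last : ∀ k (f : Fin (suc k) → ℤ) → Σℤ (suc k) f ≡ Σℤ k (f ∘ inject₁) + f (fromℕ k)
Σℤ-init-last k f = begin
  Σℤ (suc k) f                        ≡⟨ Σℤ≡sum (suc k) f ⟩
  sum f                               ≡⟨ sum-init-last f ⟩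
  sum (f ∘ inject₁) + f (fromℕ k)     ≡⟨ cong (_+ f (fromℕ k)) (Σℤ≡sum k _) ⟨
  Σℤ k (f ∘ inject₁) + f (fromℕ k)    ∎
  where open ≡-Reasoning

δ-refl : ∀ {n} (i : Fin n) → δ i i ≡ + 1
δ-refl zero    = refl
δ-refl (suc i) = δ-refl i

δ-≢ : ∀ {n} {i j : Fin n} → i ≢ j → δ i j ≡ + 0
δ-≢ {i = zero}  {zero}  i≢j = ⊥-elim (i≢j refl)
δ-≢ {i = zero}  {suc j} i≢j = refl
δ-≢ {i = suc i} {zero}  i≢j = refl
δ-≢ {i = suc i} {suc j} i≢j = δ-≢ (i≢j ∘ cong suc)

δ-sym : ∀ {n} (i j : Fin n) → δ i j ≡ δ j i
δ-sym zero    zero    = refl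
δ-sym zero    (suc j) = refl
δ-sym (suc i) zero    = refl
δ-sym (suc i) (suc j) = δ-sym i j

Σℤ-δˡ : ∀ k (i : Fin k) (f : Fin k → ℤ) → Σℤ k (λ j → δ i j * f j) ≡ f i
Σℤ-δˡ (suc k) i f = begin
  Σℤ (suc k) (λ j → δ i j * f j)                        ≡⟨ Σℤ-remove k (λ j → δ i j * f j) i ⟩
  δ i i * f i + Σℤ k (λ j → δ i (punchIn i j) * f (punchIn i j))
    ≡⟨ cong₂ _+_ (cong (_* f i) (δ-refl i)) (Σℤ-zero k off-diagonal) ⟩
  + 1 * f i + + 0                                       ≡⟨ trans (ℤP.+-identityʳ _) (ℤP.*-identityˡ _) ⟩
  f i                                                   ∎
  where
  open ≡-Reasoning
  off-diagonal : ∀ j → δ i (punchIn i j) * f (punchIn i j) ≡ + 0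
  off-diagonal j = cong (_* f (punchIn i j)) (δ-≢ (FinP.punchInᵢ≢i i j ∘ sym))

Σℤ-δʳ : ∀ k (i : Fin k) (f : Fin k → ℤ) → Σℤ k (λ j → f j * δ j i) ≡ f i
Σℤ-δʳ k i f = trans (Σℤ-cong k (λ j → trans (ℤP.*-comm (f j) (δ j i)) (cong (_* f j) (δ-sym j i))))
                    (Σℤ-δˡ k i f)

*-*-distribˡ-Σℤ : ∀ k a b (f : Fin k → ℤ) → a * (b * Σℤ k f) ≡ Σℤ k (λ j → a * (b * f j))
*-*-distribˡ-Σℤ k a b f = begin
  a * (b * Σℤ k f)              ≡⟨ ℤP.*-assoc a b _ ⟨
  a * b * Σℤ k f                ≡⟨ *-distribˡ-Σℤ k (a * b) f ⟩
  Σℤ k (λ j → a * b * f j)      ≡⟨ Σℤ-cong k (λ j → ℤP.*-assoc a b (f j)) ⟩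
  Σℤ k (λ j → a * (b * f j))    ∎
  where open ≡-Reasoning

Σℤ-assoc : ∀ k l (P : Fin k → ℤ) (Q : Fin k → Fin l → ℤ) (R : Fin l → ℤ) →
  Σℤ l (λ m → Σℤ k (λ j → P j * Q j m) * R m) ≡ Σℤ k (λ j → P j * Σℤ l (λ m → Q j m * R m))
Σℤ-assoc k l P Q R = begin
  Σℤ l (λ m → Σℤ k (λ j → P j * Q j m) * R m)   ≡⟨ Σℤ-cong l (λ m → *-distribʳ-Σℤ k (R m) (λ j → P j * Q j m)) ⟩
  Σℤ l (λ m → Σℤ k (λ j → P j * Q j m * R m))   ≡⟨ Σℤ-comm l k (λ m j → P j * Q j m * R m) ⟩
  Σℤ k (λ j → Σℤ l (λ m → P j * Q j m * R m))   ≡⟨ Σℤ-cong k (λ j → Σℤ-cong l (λ m → ℤP.*-assoc (P j) (Q j m) (R m))) ⟩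
  Σℤ k (λ j → Σℤ l (λ m → P j * (Q j m * R m))) ≡⟨ Σℤ-cong k (λ j → *-distribˡ-Σℤ l (P j) (λ m → Q j m * R m)) ⟨
  Σℤ k (λ j → P j * Σℤ l (λ m → Q j m * R m))   ∎
  where open ≡-Reasoning

Σℤ-neg : ∀ k (f : Fin k → ℤ) → Σℤ k (λ j → - f j) ≡ - Σℤ k f
Σℤ-neg k f = begin
  Σℤ k (λ j → - f j)       ≡⟨ Σℤ-cong k (λ j → ℤP.-1*i≡-i (f j)) ⟨
  Σℤ k (λ j → - + 1 * f j) ≡⟨ *-distribˡ-Σℤ k (- + 1) f ⟨
  - + 1 * Σℤ k f           ≡⟨ ℤP.-1*i≡-i (Σℤ k f) ⟩
  - Σℤ k f                 ∎
  where open ≡-Reasoning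

Σℤ-nonneg : ∀ k {f : Fin k → ℤ} → (∀ j → + 0 ≤ f j) → + 0 ≤ Σℤ k f
Σℤ-nonneg zero    f≥0 = ℤP.≤-refl
Σℤ-nonneg (suc k) f≥0 = ℤP.+-mono-≤ (f≥0 zero) (Σℤ-nonneg k (f≥0 ∘ suc))

nonneg-+-≡0 : ∀ {u v} → + 0 ≤ u → + 0 ≤ v → u + v ≡ + 0 → u ≡ + 0
nonneg-+-≡0 {u} {v} u≥0 v≥0 u+v≡0 =
  ℤP.≤-antisym (subst (u ≤_) u+v≡0 (ℤP.i≤i+j u v {{ℤ.nonNegative v≥0}})) u≥0

Σℤ-nonneg-≡0 : ∀ k {f : Fin k → ℤ} → (∀ j → + 0 ≤ f j) → Σℤ k f ≡ + 0 → ∀ j → f j ≡ + 0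
Σℤ-nonneg-≡0 (suc k) {f} f≥0 Σ≡0 zero    = nonneg-+-≡0 (f≥0 zero) (Σℤ-nonneg k (f≥0 ∘ suc)) Σ≡0
Σℤ-nonneg-≡0 (suc k) {f} f≥0 Σ≡0 (suc j) = Σℤ-nonneg-≡0 k (f≥0 ∘ suc)
  (nonneg-+-≡0 (Σℤ-nonneg k (f≥0 ∘ suc)) (f≥0 zero) (trans (ℤP.+-comm _ (f zero)) Σ≡0)) j

-- Determinants

det-cong : ∀ k {M N : Matrix k} → (∀ a b → M a b ≡ N a b) → det k M ≡ det k N
det-cong zero    M≡N = refl
det-cong (suc k) M≡N = Σℤ-cong (suc k) (λ j →
  cong₂ (λ x y → sgn (toℕ j) * (x * y)) (M≡N zero j) (det-cong k (λ a b → M≡N (suc a) (punchIn j b))))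

sgn-suc : ∀ e → sgn (suc e) ≡ - sgn e
sgn-suc zero          = refl
sgn-suc (suc zero)    = refl
sgn-suc (suc (suc e)) = sgn-suc e

sgn-+ : ∀ a b → sgn (a ℕ.+ b) ≡ sgn a * sgn b
sgn-+ zero          b = sym (ℤP.*-identityˡ _)
sgn-+ (suc zero)    b = trans (sgn-suc b) (sym (ℤP.-1*i≡-i _))
sgn-+ (suc (suc a)) b = sgn-+ a b

sgn-*-involutive : ∀ e x → sgn e * (sgn e * x) ≡ x
sgn-*-involutive e x = trans (sym (ℤP.*-assoc (sgn e) (sgn e) x))
  (trans (cong (_* x) (trans (sym (sgn-+ e e)) (sgn-even e))) (ℤP.*-identityˡ x))
  where
  sgn-even : ∀ e → sgn (e ℕ.+ e) ≡ + 1
  sgn-even zero    = refl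
  sgn-even (suc e) = trans (cong sgn (ℕP.+-suc (suc e) e)) (sgn-even e)

sgn-*-≡0 : ∀ e {x} → sgn e * x ≡ + 0 → x ≡ + 0
sgn-*-≡0 e {x} p = trans (sym (sgn-*-involutive e x)) (trans (cong (sgn e *_) p) (ℤP.*-zeroʳ (sgn e)))

rowTerm : ∀ {k} → Matrix (suc k) → Fin (suc k) → ℤ
rowTerm {k} M j = sgn (toℕ j) * (M zero j * det k (minor zero j M))

columnToFront : ∀ {k} → Fin (suc k) → Matrix (suc k) → Matrix (suc k)
columnToFront i M a zero    = M a i
columnToFront i M a (suc b) = M a (punchIn i b)

-- The position of column i among the columns other than punchIn i b.
pivot : ∀ {n} → Fin (suc (suc n)) → Fin (suc n) → Fin (suc n)
pivot zero    b = zero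
pivot (suc i) zero = i
pivot {suc n} (suc i) (suc b) = suc (pivot i b)

punchIn-pivot : ∀ {n} (i : Fin (suc (suc n))) b → punchIn (punchIn i b) (pivot i b) ≡ i
punchIn-pivot zero    b    = refl
punchIn-pivot (suc i) zero = refl
punchIn-pivot {suc n} (suc i) (suc b) = cong suc (punchIn-pivot i b)

punchIn-punchIn-pivot : ∀ {n} (i : Fin (suc (suc n))) b y →
  punchIn i (punchIn b y) ≡ punchIn (punchIn i b) (punchIn (pivot i b) y)
punchIn-punchIn-pivot zero    b    y = refl
punchIn-punchIn-pivot (suc i) zero y = refl
punchIn-punchIn-pivot {suc n} (suc i) (suc b) zero    = refl
punchIn-punchIn-pivot {suc n} (suc i) (suc b) (suc y) = cong suc (punchIn-punchIn-pivot i b y)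

toℕ-pivot : ∀ {n} (i : Fin (suc (suc n))) b →
  suc (toℕ b ℕ.+ toℕ (pivot i b)) ≡ toℕ i ℕ.+ toℕ (punchIn i b)
toℕ-pivot zero    b    = cong suc (ℕP.+-identityʳ (toℕ b))
toℕ-pivot (suc i) zero = cong suc (sym (ℕP.+-identityʳ (toℕ i)))
toℕ-pivot {suc n} (suc i) (suc b) = begin
  suc (suc (toℕ b ℕ.+ suc (toℕ (pivot i b)))) ≡⟨ cong (ℕ.suc ∘ ℕ.suc) (ℕP.+-suc (toℕ b) _) ⟩
  suc (suc (suc (toℕ b ℕ.+ toℕ (pivot i b))))  ≡⟨ cong (ℕ.suc ∘ ℕ.suc) (toℕ-pivot i b) ⟩
  suc (suc (toℕ i ℕ.+ toℕ (punchIn i b)))      ≡⟨ cong suc (ℕP.+-suc (toℕ i) _) ⟨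
  suc (toℕ i ℕ.+ suc (toℕ (punchIn i b)))      ∎
  where open ≡-Reasoning

sgn-pivot : ∀ {n} (i : Fin (suc (suc n))) b →
  sgn (suc (toℕ b)) * sgn (toℕ (pivot i b)) ≡ sgn (toℕ i) * sgn (toℕ (punchIn i b))
sgn-pivot i b = begin
  sgn (suc (toℕ b)) * sgn (toℕ (pivot i b)) ≡⟨ sgn-+ (suc (toℕ b)) _ ⟨
  sgn (suc (toℕ b ℕ.+ toℕ (pivot i b)))     ≡⟨ cong sgn (toℕ-pivot i b) ⟩
  sgn (toℕ i ℕ.+ toℕ (punchIn i b))         ≡⟨ sgn-+ (toℕ i) _ ⟩
  sgn (toℕ i) * sgn (toℕ (punchIn i b))     ∎
  where open ≡-Reasoning

det-columnToFront : ∀ k (M : Matrix (suc k)) i →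
  det (suc k) (columnToFront i M) ≡ sgn (toℕ i) * det (suc k) M
det-columnToFront zero    M zero = sym (ℤP.*-identityˡ _)
det-columnToFront (suc k) M i = begin
  det (suc (suc k)) (columnToFront i M)
    ≡⟨ cong₂ _+_ leading-term (Σℤ-cong (suc k) shifted-term) ⟩
  s * rowTerm M i + Σℤ (suc k) (λ b → s * rowTerm M (punchIn i b))
    ≡⟨ cong (ℤ._+_ (s * rowTerm M i)) (*-distribˡ-Σℤ (suc k) s (rowTerm M ∘ punchIn i)) ⟨
  s * rowTerm M i + s * Σℤ (suc k) (rowTerm M ∘ punchIn i)
    ≡⟨ ℤP.*-distribˡ-+ s _ _ ⟨
  s * (rowTerm M i + Σℤ (suc k) (rowTerm M ∘ punchIn i))
    ≡⟨ cong (s *_) (Σℤ-remove (suc k) (rowTerm M) i) ⟨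
  s * det (suc (suc k)) M ∎
  where
  open ≡-Reasoning
  s = sgn (toℕ i)
  leading-term : rowTerm (columnToFront i M) zero ≡ s * rowTerm M i
  leading-term = trans (ℤP.*-identityˡ _) (sym (sgn-*-involutive (toℕ i) _))
  shifted-term : ∀ b → rowTerm (columnToFront i M) (suc b) ≡ s * rowTerm M (punchIn i b)
  shifted-term b = begin
    sgn (suc (toℕ b)) * (x * det (suc k) (minor zero (suc b) (columnToFront i M)))
      ≡⟨ cong (λ z → sgn (suc (toℕ b)) * (x * z)) (trans
           (det-cong (suc k) minor-columnToFront) (det-columnToFront k N (pivot i b))) ⟩
    sgn (suc (toℕ b)) * (x * (sgn (toℕ (pivot i b)) * det (suc k) N))
      ≡⟨ rearrange (sgn (suc (toℕ b))) (sgn (toℕ (pivot i b))) x (det (suc k) N) ⟩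
    sgn (suc (toℕ b)) * sgn (toℕ (pivot i b)) * (x * det (suc k) N)
      ≡⟨ cong (_* (x * det (suc k) N)) (sgn-pivot i b) ⟩
    s * sgn (toℕ (punchIn i b)) * (x * det (suc k) N)
      ≡⟨ ℤP.*-assoc s _ _ ⟩
    s * rowTerm M (punchIn i b) ∎
    where
    x = M zero (punchIn i b)
    N = minor zero (punchIn i b) M
    rearrange : ∀ a c x y → a * (x * (c * y)) ≡ a * c * (x * y)
    rearrange = solve-∀
    minor-columnToFront : ∀ x y → minor zero (suc b) (columnToFront i M) x y ≡ columnToFront (pivot i b) N x y
    minor-columnToFront x zero    = cong (M (suc x)) (sym (punchIn-pivot i b))
    minor-columnToFront x (suc y) = cong (M (suc x)) (punchIn-punchIn-pivot i b y)

det-expandColumn₀ : ∀ k (N : Matrix (suc k)) →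
  det (suc k) N ≡ Σℤ (suc k) (λ j → sgn (toℕ j) * (N j zero * det k (minor j zero N)))
det-expandColumn₀ zero    N = refl
det-expandColumn₀ (suc k) N = cong (ℤ._+_ (rowTerm N zero)) (begin
  Σℤ (suc k) (λ b → sgn (suc (toℕ b)) * (X b * det (suc k) (minor zero (suc b) N)))
    ≡⟨ Σℤ-cong (suc k) (λ b → cong (λ z → sgn (suc (toℕ b)) * (X b * z)) (det-expandColumn₀ k (minor zero (suc b) N))) ⟩
  Σℤ (suc k) (λ b → sgn (suc (toℕ b)) * (X b * Σℤ (suc k) (λ j → sgn (toℕ j) * (Y j * Z b j))))
    ≡⟨ Σℤ-cong (suc k) (λ b → *-*-distribˡ-Σℤ (suc k) (sgn (suc (toℕ b))) (X b) (λ j → sgn (toℕ j) * (Y j * Z b j))) ⟩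
  Σℤ (suc k) (λ b → Σℤ (suc k) (λ j → sgn (suc (toℕ b)) * (X b * (sgn (toℕ j) * (Y j * Z b j)))))
    ≡⟨ Σℤ-cong (suc k) (λ b → Σℤ-cong (suc k) (swap-signs b)) ⟩
  Σℤ (suc k) (λ b → Σℤ (suc k) (λ j → sgn (suc (toℕ j)) * (Y j * (sgn (toℕ b) * (X b * Z b j)))))
    ≡⟨ Σℤ-comm (suc k) (suc k) (λ b j → sgn (suc (toℕ j)) * (Y j * (sgn (toℕ b) * (X b * Z b j)))) ⟩
  Σℤ (suc k) (λ j → Σℤ (suc k) (λ b → sgn (suc (toℕ j)) * (Y j * (sgn (toℕ b) * (X b * Z b j)))))
    ≡⟨ Σℤ-cong (suc k) (λ j → *-*-distribˡ-Σℤ (suc k) (sgn (suc (toℕ j))) (Y j) (λ b → sgn (toℕ b) * (X b * Z b j))) ⟨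
  Σℤ (suc k) (λ j → sgn (suc (toℕ j)) * (Y j * Σℤ (suc k) (λ b → sgn (toℕ b) * (X b * Z b j)))) ∎)
  where
  open ≡-Reasoning
  X Y : Fin (suc k) → ℤ
  X b = N zero (suc b)
  Y j = N (suc j) zero
  -- N without rows 0, 1+j and columns 0, 1+b: the minor reached by both expansions
  Z : Fin (suc k) → Fin (suc k) → ℤ
  Z b j = det k (minor zero b (minor (suc j) zero N))
  swap-signs : ∀ b j → sgn (suc (toℕ b)) * (X b * (sgn (toℕ j) * (Y j * Z b j))) ≡
                       sgn (suc (toℕ j)) * (Y j * (sgn (toℕ b) * (X b * Z b j)))
  swap-signs b j rewrite sgn-suc (toℕ b) | sgn-suc (toℕ j) = swap (sgn (toℕ b)) (sgn (toℕ j)) (X b) (Y j) (Z b j)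
    where
    swap : ∀ p q x y z → - p * (x * (q * (y * z))) ≡ - q * (y * (p * (x * z)))
    swap = solve-∀

det-expandColumn : ∀ k (M : Matrix (suc k)) i →
  det (suc k) M ≡ Σℤ (suc k) (λ j → sgn (toℕ i ℕ.+ toℕ j) * (M j i * det k (minor j i M)))
det-expandColumn k M i = begin
  det (suc k) M                                       ≡⟨ sgn-*-involutive (toℕ i) (det (suc k) M) ⟨
  s * (s * det (suc k) M)                             ≡⟨ cong (s *_) (det-columnToFront k M i) ⟨
  s * det (suc k) (columnToFront i M)                 ≡⟨ cong (s *_) (det-expandColumn₀ k (columnToFront i M)) ⟩
  s * Σℤ (suc k) (λ j → sgn (toℕ j) * X j)            ≡⟨ *-distribˡ-Σℤ (suc k) s (λ j → sgn (toℕ j) * X j) ⟩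
  Σℤ (suc k) (λ j → s * (sgn (toℕ j) * X j))          ≡⟨ Σℤ-cong (suc k) (λ j → ℤP.*-assoc s (sgn (toℕ j)) (X j)) ⟨
  Σℤ (suc k) (λ j → s * sgn (toℕ j) * X j)            ≡⟨ Σℤ-cong (suc k) (λ j → cong (_* X j) (sgn-+ (toℕ i) (toℕ j))) ⟨
  Σℤ (suc k) (λ j → sgn (toℕ i ℕ.+ toℕ j) * X j)      ∎
  where
  open ≡-Reasoning
  s = sgn (toℕ i)
  X : Fin (suc k) → ℤ
  X j = M j i * det k (minor j i M)

det-equalColumns₀₁ : ∀ k (N : Matrix (suc (suc k))) →
  (∀ a → N a zero ≡ N a (suc zero)) → det (suc (suc k)) N ≡ + 0
rowTerm-equalColumns₀₁ : ∀ k (N : Matrix (suc (suc k))) →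
  (∀ a → N a zero ≡ N a (suc zero)) → (b : Fin k) → rowTerm N (suc (suc b)) ≡ + 0

det-equalColumns₀₁ k N h = begin
  rowTerm N zero + (rowTerm N (suc zero) + Σℤ k (λ b → rowTerm N (suc (suc b))))
    ≡⟨ cong₂ (λ u v → rowTerm N zero + (sgn 1 * u + v))
         (cong₂ _*_ (sym (h zero)) (det-cong (suc k) minors-agree)) (Σℤ-zero k (rowTerm-equalColumns₀₁ k N h)) ⟩
  rowTerm N zero + (sgn 1 * (N zero zero * det (suc k) (minor zero zero N)) + + 0)
    ≡⟨ cancel (N zero zero * det (suc k) (minor zero zero N)) ⟩
  + 0 ∎
  where
  open ≡-Reasoning
  minors-agree : ∀ a b → minor zero (suc zero) N a b ≡ minor zero zero N a b
  minors-agree a zero    = h (suc a)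
  minors-agree a (suc b) = refl
  cancel : ∀ x → + 1 * x + (- + 1 * x + + 0) ≡ + 0
  cancel = solve-∀

rowTerm-equalColumns₀₁ (suc k) N h b = begin
  sgn (toℕ b) * (N zero (suc (suc b)) * det (suc (suc k)) (minor zero (suc (suc b)) N))
    ≡⟨ cong (λ d → sgn (toℕ b) * (N zero (suc (suc b)) * d)) (det-equalColumns₀₁ k (minor zero (suc (suc b)) N) (h ∘ suc)) ⟩
  sgn (toℕ b) * (N zero (suc (suc b)) * + 0)
    ≡⟨ trans (cong (sgn (toℕ b) *_) (ℤP.*-zeroʳ (N zero (suc (suc b))))) (ℤP.*-zeroʳ (sgn (toℕ b))) ⟩
  + 0 ∎
  where open ≡-Reasoning

det-equalColumns : ∀ k (M : Matrix (suc k)) {i l} → i ≢ l → (∀ a → M a i ≡ M a l) → det (suc k) M ≡ + 0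
det-equalColumns zero    M {zero} {zero} i≢l _ = ⊥-elim (i≢l refl)
det-equalColumns (suc k) M {i} {l} i≢l h =
  sgn-*-≡0 (toℕ i) (trans (sym (det-columnToFront (suc k) M i))
    (sgn-*-≡0 (suc (toℕ b)) (trans (sym (det-columnToFront (suc k) M′ (suc b)))
      (det-equalColumns₀₁ k (columnToFront (suc b) M′) (λ a → trans (cong (M a) (FinP.punchIn-punchOut i≢l)) (sym (h a)))))))
  where
  b  = punchOut i≢l
  M′ = columnToFront i M

replaceColumn : ∀ {k} → Fin k → Fin k → Matrix k → Matrix k
replaceColumn i l M a = updateAt (M a) i (λ _ → M a l)

adj-row-·-column : ∀ k (M : Matrix (suc k)) i l →
  Σℤ (suc k) (λ j → adj (suc k) M i j * M j l) ≡ det (suc k) (replaceColumn i l M)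
adj-row-·-column k M i l = begin
  Σℤ (suc k) (λ j → s j * det k (minor j i M) * M j l)     ≡⟨ Σℤ-cong (suc k) (λ j → reorder (s j) (det k (minor j i M)) (M j l)) ⟩
  Σℤ (suc k) (λ j → s j * (M j l * det k (minor j i M)))   ≡⟨ Σℤ-cong (suc k) (λ j → cong₂ (λ x d → s j * (x * d))
                                                                 (sym (updateAt-updates i {λ _ → M j l} (M j)))
                                                                 (det-cong k (λ x y → sym (unchanged (punchIn j x) y)))) ⟩
  Σℤ (suc k) (λ j → s j * (M′ j i * det k (minor j i M′))) ≡⟨ det-expandColumn k M′ i ⟨
  det (suc k) M′                                           ∎
  where
  open ≡-Reasoning
  M′ = replaceColumn i l M
  s : Fin (suc k) → ℤ
  s j = sgn (toℕ i ℕ.+ toℕ j)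
  reorder : ∀ s d m → s * d * m ≡ s * (m * d)
  reorder = solve-∀
  unchanged : ∀ a y → M′ a (punchIn i y) ≡ M a (punchIn i y)
  unchanged a y = updateAt-minimal (punchIn i y) i {λ _ → M a l} (M a) (FinP.punchInᵢ≢i i y)

adj-mulˡ : ∀ k (M : Matrix k) i l → Σℤ k (λ j → adj k M i j * M j l) ≡ δ i l * det k M
adj-mulˡ (suc k) M i l with i Fin.≟ l
... | yes refl = begin
  Σℤ (suc k) (λ j → adj (suc k) M i j * M j i) ≡⟨ adj-row-·-column k M i i ⟩
  det (suc k) (replaceColumn i i M)            ≡⟨ det-cong (suc k) (λ a → updateAt-id-local i {λ _ → M a i} (M a) refl) ⟩
  det (suc k) M                                ≡⟨ ℤP.*-identityˡ (det (suc k) M) ⟨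
  + 1 * det (suc k) M                          ≡⟨ cong (_* det (suc k) M) (δ-refl i) ⟨
  δ i i * det (suc k) M                        ∎
  where open ≡-Reasoning
... | no i≢l = begin
  Σℤ (suc k) (λ j → adj (suc k) M i j * M j l) ≡⟨ adj-row-·-column k M i l ⟩
  det (suc k) (replaceColumn i l M)            ≡⟨ det-equalColumns k (replaceColumn i l M) i≢l equal ⟩
  + 0                                          ≡⟨ ℤP.*-zeroˡ (det (suc k) M) ⟨
  + 0 * det (suc k) M                          ≡⟨ cong (_* det (suc k) M) (δ-≢ i≢l) ⟨
  δ i l * det (suc k) M                        ∎
  where
  open ≡-Reasoning
  equal : ∀ a → replaceColumn i l M a i ≡ replaceColumn i l M a l
  equal a = trans (updateAt-updates i {λ _ → M a l} (M a)) (sym (updateAt-minimal l i {λ _ → M a l} (M a) (i≢l ∘ sym)))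

-- Weakly chained diagonally dominant matrices

IsSymmetric : ∀ {k} → Matrix k → Set
IsSymmetric M = ∀ a b → M a b ≡ M b a

HasTrivialKernel : ∀ {k} → Matrix k → Set
HasTrivialKernel M = ∀ x → (∀ a → (M ·ᵥ x) a ≡ + 0) → ∀ a → x a ≡ + 0

rowSum : ∀ {k} → Matrix k → Fin k → ℤ
rowSum {k} M a = Σℤ k (M a)

data ChainToDominantRow {k} (M : Matrix k) : Fin k → Set where
  dominant : ∀ {a} → + 0 < rowSum M a → ChainToDominantRow M a
  link     : ∀ {a b} → M a b < + 0 → ChainToDominantRow M b → ChainToDominantRow M a

-- For a matrix with nonpositive off-diagonal entries, a nonnegative row sum is weak
-- diagonal dominance: these are the weakly chained diagonally dominant Z-matrices.
record IsWeaklyChainedDominant {k} (M : Matrix k) : Set where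
  field
    offDiagonal≤0 : ∀ {a b} → a ≢ b → M a b ≤ + 0
    rowSum≥0      : ∀ a → + 0 ≤ rowSum M a
    chained       : ∀ a → ChainToDominantRow M a

argmax : ∀ k (x : Fin (suc k) → ℤ) → ∃ λ c → ∀ b → x b ≤ x c
argmax zero    x = zero , λ { zero → ℤP.≤-refl }
argmax (suc k) x with argmax k (x ∘ suc)
... | c , x≤xc with ℤP.≤-total (x zero) (x (suc c))
...   | inj₁ x₀≤ = suc c , λ { zero → x₀≤ ; (suc b) → x≤xc b }
...   | inj₂ ≤x₀ = zero , λ { zero → ℤP.≤-refl ; (suc b) → ℤP.≤-trans (x≤xc b) ≤x₀ }

module MaximumPrinciple {k} {M : Matrix k} (wcdd : IsWeaklyChainedDominant M)
  (x : Fin k → ℤ) (Mx≡0 : ∀ a → (M ·ᵥ x) a ≡ + 0)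
  (μ : ℤ) (x≤μ : ∀ b → x b ≤ μ) (μ>0 : + 0 < μ) where

  open IsWeaklyChainedDominant wcdd

  gap : Fin k → Fin k → ℤ
  gap a b = M a b * (x b - μ)

  row-split : ∀ a → (M ·ᵥ x) a ≡ rowSum M a * μ + Σℤ k (gap a)
  row-split a = begin
    Σℤ k (λ b → M a b * x b)                       ≡⟨ Σℤ-cong k (λ b → split (M a b) (x b) μ) ⟩
    Σℤ k (λ b → M a b * μ + gap a b)               ≡⟨ Σℤ-distrib-+ k (λ b → M a b * μ) (gap a) ⟩
    Σℤ k (λ b → M a b * μ) + Σℤ k (gap a)          ≡⟨ cong (_+ Σℤ k (gap a)) (*-distribʳ-Σℤ k μ (M a)) ⟨
    rowSum M a * μ + Σℤ k (gap a)                  ∎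
    where
    open ≡-Reasoning
    split : ∀ m y μ → m * y ≡ m * μ + m * (y - μ)
    split = solve-∀

  gap≥0 : ∀ {a} → x a ≡ μ → ∀ b → + 0 ≤ gap a b
  gap≥0 {a} xa≡μ b with a Fin.≟ b
  ... | yes refl = ℤP.≤-reflexive (sym (trans (cong (λ y → M a a * (y - μ)) xa≡μ)
                     (trans (cong (M a a *_) (ℤP.+-inverseʳ μ)) (ℤP.*-zeroʳ (M a a)))))
  ... | no a≢b = ℤP.≤-trans (ℤP.≤-reflexive (sym (ℤP.*-zeroʳ (M a b))))
                   (ℤP.*-monoˡ-≤-nonPos (M a b) {{ℤ.nonPositive (offDiagonal≤0 a≢b)}} (ℤP.i≤j⇒i-j≤0 (x≤μ b)))

  row-at-maximum : ∀ {a} → x a ≡ μ → rowSum M a * μ ≡ + 0 × Σℤ k (gap a) ≡ + 0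
  row-at-maximum {a} xa≡μ =
    nonneg-+-≡0 dominance≥0 gaps≥0 row≡0 ,
    nonneg-+-≡0 gaps≥0 dominance≥0 (trans (ℤP.+-comm (Σℤ k (gap a)) (rowSum M a * μ)) row≡0)
    where
    dominance≥0 : + 0 ≤ rowSum M a * μ
    dominance≥0 = ℤP.*-monoʳ-≤-nonNeg μ {{ℤ.nonNegative (ℤP.<⇒≤ μ>0)}} (rowSum≥0 a)
    gaps≥0 : + 0 ≤ Σℤ k (gap a)
    gaps≥0 = Σℤ-nonneg k (gap≥0 xa≡μ)
    row≡0 : rowSum M a * μ + Σℤ k (gap a) ≡ + 0
    row≡0 = trans (sym (row-split a)) (Mx≡0 a)

  -- the maximum propagates along the chain and cannot be attained in a strictly dominant row
  no-chain : ∀ {a} → ChainToDominantRow M a → x a ≢ μ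
  no-chain {a} (dominant rowSum>0) xa≡μ with ℤP.i*j≡0⇒i≡0∨j≡0 (rowSum M a) (proj₁ (row-at-maximum xa≡μ))
  ... | inj₁ rowSum≡0 = ℤP.<-irrefl (sym rowSum≡0) rowSum>0
  ... | inj₂ μ≡0      = ℤP.<-irrefl (sym μ≡0) μ>0
  no-chain {a} (link {b = b} Mab<0 chain) xa≡μ
    with ℤP.i*j≡0⇒i≡0∨j≡0 (M a b) (Σℤ-nonneg-≡0 k (gap≥0 xa≡μ) (proj₂ (row-at-maximum xa≡μ)) b)
  ... | inj₁ Mab≡0  = ℤP.<-irrefl Mab≡0 Mab<0
  ... | inj₂ gap≡0  = no-chain chain (ℤP.i-j≡0⇒i≡j (x b) μ gap≡0)

maximum-principle : ∀ k {M : Matrix k} → IsWeaklyChainedDominant M →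
  ∀ x → (∀ a → (M ·ᵥ x) a ≡ + 0) → ∀ a → x a ≤ + 0
maximum-principle (suc k) wcdd x Mx≡0 a with argmax k x
... | c , x≤xc with x c ℤP.≤? + 0
...   | yes xc≤0 = ℤP.≤-trans (x≤xc a) xc≤0
...   | no  xc≰0 = ⊥-elim (MaximumPrinciple.no-chain wcdd x Mx≡0 (x c) x≤xc (ℤP.≰⇒> xc≰0)
                     (IsWeaklyChainedDominant.chained wcdd c) refl)

kernel-trivial : ∀ {k} {M : Matrix k} → IsWeaklyChainedDominant M → HasTrivialKernel M
kernel-trivial {k} {M} wcdd x Mx≡0 a = ℤP.≤-antisym (maximum-principle k wcdd x Mx≡0 a)
  (ℤP.neg-cancel-≤ (maximum-principle k wcdd (λ b → - x b) M[-x]≡0 a))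
  where
  M[-x]≡0 : ∀ a → (M ·ᵥ (λ b → - x b)) a ≡ + 0
  M[-x]≡0 a = trans (Σℤ-cong k (λ b → sym (ℤP.neg-distribʳ-* (M a b) (x b))))
                    (trans (Σℤ-neg k (λ b → M a b * x b)) (cong -_ (Mx≡0 a)))

-- rowSum M (suc a) unfolds to M (suc a) zero + rowSum (minor zero zero M) a.
wcdd-minor₀₀ : ∀ {k} {M : Matrix (suc k)} → IsWeaklyChainedDominant M →
  IsWeaklyChainedDominant (minor zero zero M)
wcdd-minor₀₀ {k} {M} wcdd = record
  { offDiagonal≤0 = λ a≢b → offDiagonal≤0 (a≢b ∘ FinP.suc-injective)
  ; rowSum≥0      = λ a → ℤP.≤-trans (rowSum≥0 (suc a)) (drop-nonpos (offDiagonal≤0 (λ ())))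
  ; chained       = λ a → chain-minor (chained (suc a))
  }
  where
  open IsWeaklyChainedDominant wcdd
  drop-nonpos : ∀ {x y} → x ≤ + 0 → x + y ≤ y
  drop-nonpos {x} {y} x≤0 = ℤP.≤-trans (ℤP.+-monoˡ-≤ y x≤0) (ℤP.≤-reflexive (ℤP.+-identityˡ y))
  drop-neg : ∀ {x y} → x < + 0 → x + y < y
  drop-neg {x} {y} x<0 = ℤP.<-≤-trans (ℤP.+-monoˡ-< y x<0) (ℤP.≤-reflexive (ℤP.+-identityˡ y))
  chain-minor : ∀ {a} → ChainToDominantRow M (suc a) → ChainToDominantRow (minor zero zero M) a
  chain-minor (dominant p) = dominant (ℤP.<-≤-trans p (drop-nonpos (offDiagonal≤0 (λ ()))))
  chain-minor {a} (link {b = zero} Ma0<0 _) = dominant (ℤP.≤-<-trans (rowSum≥0 (suc a)) (drop-neg Ma0<0))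
  chain-minor (link {b = suc b} Mab<0 chain) = link Mab<0 (chain-minor chain)

det≢0 : ∀ k {M : Matrix k} → IsSymmetric M → IsWeaklyChainedDominant M → det k M ≢ + 0
det≢0 zero    _ _ ()
det≢0 (suc k) {M} M-sym wcdd det≡0 =
  det≢0 k (λ a b → M-sym (suc a) (suc b)) (wcdd-minor₀₀ wcdd)
    (trans (sym (ℤP.*-identityˡ (det k (minor zero zero M)))) (first-adj-row≡0 zero))
  where
  -- By symmetry, adj M · M = det M · I = 0 puts the first row of adj M, whose first entry is
  -- det (minor zero zero M), into the kernel of M.
  c : Fin (suc k) → ℤ
  c = adj (suc k) M zero
  first-adj-row≡0 : ∀ j → c j ≡ + 0
  first-adj-row≡0 = kernel-trivial wcdd c (λ l → begin
    Σℤ (suc k) (λ j → M l j * c j)                  ≡⟨ Σℤ-cong (suc k) (λ j → trans (cong (_* c j) (M-sym l j)) (ℤP.*-comm (M j l) (c j))) ⟩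
    Σℤ (suc k) (λ j → c j * M j l)                  ≡⟨ adj-mulˡ (suc k) M zero l ⟩
    δ zero l * det (suc k) M                        ≡⟨ cong (δ zero l *_) det≡0 ⟩
    δ zero l * + 0                                  ≡⟨ ℤP.*-zeroʳ (δ zero l) ⟩
    + 0                                             ∎)
    where open ≡-Reasoning

-- By symmetry and adj M · M = det M · I, the defect M · adj M − det M · I lies in the kernel of M.
adj-mulʳ : ∀ k (M : Matrix k) → IsSymmetric M → HasTrivialKernel M →
  ∀ i l → Σℤ k (λ j → M i j * adj k M j l) ≡ δ i l * det k M
adj-mulʳ k M M-sym M-injective i l = ℤP.i-j≡0⇒i≡j (P l) (δ i l * det k M) (M-injective defect M·defect≡0 l)
  where
  d = det k M
  P defect : Fin k → ℤ
  P l = Σℤ k (λ j → M i j * adj k M j l)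
  defect l = P l - δ i l * d
  M·defect≡0 : ∀ m → (M ·ᵥ defect) m ≡ + 0
  M·defect≡0 m = begin
    Σℤ k (λ l → M m l * defect l)
      ≡⟨ Σℤ-cong k (λ l → trans (cong (_* defect l) (M-sym m l)) (ℤP.*-comm (M l m) (defect l))) ⟩
    Σℤ k (λ l → defect l * M l m)
      ≡⟨ Σℤ-cong k (λ l → ℤP.*-distribʳ-+ (M l m) (P l) (- (δ i l * d))) ⟩
    Σℤ k (λ l → Σℤ k (λ j → M i j * adj k M j l) * M l m + - (δ i l * d) * M l m)
      ≡⟨ Σℤ-distrib-+ k (λ l → P l * M l m) (λ l → - (δ i l * d) * M l m) ⟩
    Σℤ k (λ l → Σℤ k (λ j → M i j * adj k M j l) * M l m) + Σℤ k (λ l → - (δ i l * d) * M l m)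
      ≡⟨ cong₂ _+_ (Σℤ-assoc k k (M i) (adj k M) (λ l → M l m)) (Σℤ-cong k (λ l → pull-d (δ i l) d (M l m))) ⟩
    Σℤ k (λ j → M i j * Σℤ k (λ l → adj k M j l * M l m)) + Σℤ k (λ l → - d * (δ i l * M l m))
      ≡⟨ cong₂ _+_ (Σℤ-cong k (λ j → cong (M i j *_) (adj-mulˡ k M j m)))
                   (sym (*-distribˡ-Σℤ k (- d) (λ l → δ i l * M l m))) ⟩
    Σℤ k (λ j → M i j * (δ j m * d)) + - d * Σℤ k (λ l → δ i l * M l m)
      ≡⟨ cong₂ _+_ (Σℤ-cong k (λ j → sym (ℤP.*-assoc (M i j) (δ j m) d))) (cong (- d *_) (Σℤ-δˡ k i (λ l → M l m))) ⟩
    Σℤ k (λ j → M i j * δ j m * d) + - d * M i m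
      ≡⟨ cong (_+ - d * M i m) (trans (sym (*-distribʳ-Σℤ k d (λ j → M i j * δ j m))) (cong (_* d) (Σℤ-δʳ k m (M i)))) ⟩
    M i m * d + - d * M i m
      ≡⟨ cancel (M i m) d ⟩
    + 0 ∎
    where
    open ≡-Reasoning
    pull-d : ∀ δ d m → - (δ * d) * m ≡ - d * (δ * m)
    pull-d = solve-∀
    cancel : ∀ x d → x * d + - d * x ≡ + 0
    cancel = solve-∀

-- Integer solvability of linear systems

·ᵥ-·ᵥ : ∀ k (P Q : Matrix k) x a → (P ·ᵥ (Q ·ᵥ x)) a ≡ Σℤ k (λ c → Σℤ k (λ b → P a b * Q b c) * x c)
·ᵥ-·ᵥ k P Q x a = sym (Σℤ-assoc k k (P a) Q x)

Σℤ-δ-scaled : ∀ k b d (x : Fin k → ℤ) → Σℤ k (λ c → δ b c * d * x c) ≡ d * x b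
Σℤ-δ-scaled k b d x = trans (Σℤ-cong k (λ c → ℤP.*-assoc (δ b c) d (x c))) (Σℤ-δˡ k b (λ c → d * x c))

adj-cancelˡ : ∀ k (M : Matrix k) τ b → (adj k M ·ᵥ (M ·ᵥ τ)) b ≡ det k M * τ b
adj-cancelˡ k M τ b = begin
  (adj k M ·ᵥ (M ·ᵥ τ)) b                                    ≡⟨ ·ᵥ-·ᵥ k (adj k M) M τ b ⟩
  Σℤ k (λ c → Σℤ k (λ a → adj k M b a * M a c) * τ c)        ≡⟨ Σℤ-cong k (λ c → cong (_* τ c) (adj-mulˡ k M b c)) ⟩
  Σℤ k (λ c → δ b c * det k M * τ c)                         ≡⟨ Σℤ-δ-scaled k b (det k M) τ ⟩
  det k M * τ b                                              ∎
  where open ≡-Reasoning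

adj-cancelʳ : ∀ k (M : Matrix k) → IsSymmetric M → HasTrivialKernel M →
  ∀ y a → (M ·ᵥ (adj k M ·ᵥ y)) a ≡ det k M * y a
adj-cancelʳ k M M-sym M-injective y a = begin
  (M ·ᵥ (adj k M ·ᵥ y)) a                                    ≡⟨ ·ᵥ-·ᵥ k M (adj k M) y a ⟩
  Σℤ k (λ c → Σℤ k (λ b → M a b * adj k M b c) * y c)        ≡⟨ Σℤ-cong k (λ c → cong (_* y c) (adj-mulʳ k M M-sym M-injective a c)) ⟩
  Σℤ k (λ c → δ a c * det k M * y c)                         ≡⟨ Σℤ-δ-scaled k a (det k M) y ⟩
  det k M * y a                                              ∎
  where open ≡-Reasoning

solvable⇔det∣adj : ∀ k (M : Matrix k) → IsSymmetric M → IsWeaklyChainedDominant M → ∀ y →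
  (∃ λ τ → ∀ a → (M ·ᵥ τ) a ≡ y a) ⇔ (∀ b → det k M ∣ (adj k M ·ᵥ y) b)
solvable⇔det∣adj k M M-sym wcdd y = mk⇔ to from
  where
  d = det k M
  to : (∃ λ τ → ∀ a → (M ·ᵥ τ) a ≡ y a) → ∀ b → d ∣ (adj k M ·ᵥ y) b
  to (τ , Mτ≡y) b = divides (τ b) (begin
    (adj k M ·ᵥ y) b         ≡⟨ Σℤ-cong k (λ a → cong (adj k M b a *_) (Mτ≡y a)) ⟨
    (adj k M ·ᵥ (M ·ᵥ τ)) b  ≡⟨ adj-cancelˡ k M τ b ⟩
    d * τ b                  ≡⟨ ℤP.*-comm d (τ b) ⟩
    τ b * d                  ∎)
    where open ≡-Reasoning
  from : (∀ b → d ∣ (adj k M ·ᵥ y) b) → ∃ λ τ → ∀ a → (M ·ᵥ τ) a ≡ y a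
  from d∣ = τ , λ a → ℤP.*-cancelˡ-≡ d ((M ·ᵥ τ) a) (y a) {{ℤ.≢-nonZero (det≢0 k M-sym wcdd)}} (begin
    d * (M ·ᵥ τ) a                  ≡⟨ *-distribˡ-Σℤ k d (λ b → M a b * τ b) ⟩
    Σℤ k (λ b → d * (M a b * τ b))  ≡⟨ Σℤ-cong k (λ b → trans (swap d (M a b) (τ b)) (cong (M a b *_) (sym (adj·y≡τ*d b)))) ⟩
    (M ·ᵥ (adj k M ·ᵥ y)) a         ≡⟨ adj-cancelʳ k M M-sym (kernel-trivial wcdd) y a ⟩
    d * y a                         ∎)
    where
    open ≡-Reasoning
    τ : Fin k → ℤ
    τ b = _∣_.quotient (d∣ b)
    adj·y≡τ*d : ∀ b → (adj k M ·ᵥ y) b ≡ τ b * d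
    adj·y≡τ*d b = _∣_.equality (d∣ b)
    swap : ∀ d m t → d * (m * t) ≡ m * (t * d)
    swap = solve-∀

-- Divisors and graph Laplacians

data InitLastView {k} : Fin (suc k) → Set where
  last : InitLastView (fromℕ k)
  init : (b : Fin k) → InitLastView (inject₁ b)

initLastView : ∀ {k} (j : Fin (suc k)) → InitLastView j
initLastView {zero}  zero    = last
initLastView {suc k} zero    = init zero
initLastView {suc k} (suc j) with initLastView j
... | last   = last
... | init b = init (suc b)

punchIn-fromℕ : ∀ {k} (j : Fin k) → punchIn (fromℕ k) j ≡ inject₁ j
punchIn-fromℕ zero    = refl
punchIn-fromℕ (suc j) = cong suc (punchIn-fromℕ j)

infixl 5 _∷ʳ_
_∷ʳ_ : ∀ {k} → (Fin k → ℤ) → ℤ → Fin (suc k) → ℤ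
_∷ʳ_ {k} xs x = insertAt xs (fromℕ k) x

∷ʳ-init : ∀ {k} (xs : Fin k → ℤ) x b → (xs ∷ʳ x) (inject₁ b) ≡ xs b
∷ʳ-init {k} xs x b = trans (cong (xs ∷ʳ x) (sym (punchIn-fromℕ b))) (insertAt-punchIn xs (fromℕ k) x b)

∷ʳ-last : ∀ {k} (xs : Fin k → ℤ) x → (xs ∷ʳ x) (fromℕ k) ≡ x
∷ʳ-last {k} xs x = insertAt-lookup xs (fromℕ k) x

∷ʳ-neg-sum-deg0 : ∀ {k} (x : Fin k → ℤ) → IsDeg0 (x ∷ʳ - Σℤ k x)
∷ʳ-neg-sum-deg0 {k} x = begin
  Σℤ (suc k) (x ∷ʳ - Σℤ k x)                                    ≡⟨ Σℤ-init-last k (x ∷ʳ - Σℤ k x) ⟩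
  Σℤ k ((x ∷ʳ - Σℤ k x) ∘ inject₁) + (x ∷ʳ - Σℤ k x) (fromℕ k)  ≡⟨ cong₂ _+_ (Σℤ-cong k (∷ʳ-init x _)) (∷ʳ-last x _) ⟩
  Σℤ k x - Σℤ k x                                               ≡⟨ ℤP.+-inverseʳ (Σℤ k x) ⟩
  + 0                                                           ∎
  where open ≡-Reasoning

deg0-agree-on-init : ∀ {k} {E E′ : Divisor (suc k)} → IsDeg0 E → IsDeg0 E′ →
  (∀ b → E (inject₁ b) ≡ E′ (inject₁ b)) → ∀ i → E i ≡ E′ i
deg0-agree-on-init {k} {E} {E′} E⁰ E′⁰ agree i with initLastView i
... | init b = agree b
... | last   = ∙-cancelˡ (Σℤ k (E ∘ inject₁)) (E (fromℕ k)) (E′ (fromℕ k)) (begin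
  Σℤ k (E ∘ inject₁) + E (fromℕ k)    ≡⟨ Σℤ-init-last k E ⟨
  Σℤ (suc k) E                        ≡⟨ trans E⁰ (sym E′⁰) ⟩
  Σℤ (suc k) E′                       ≡⟨ Σℤ-init-last k E′ ⟩
  Σℤ k (E′ ∘ inject₁) + E′ (fromℕ k)  ≡⟨ cong (_+ E′ (fromℕ k)) (Σℤ-cong k agree) ⟨
  Σℤ k (E ∘ inject₁) + E′ (fromℕ k)   ∎)
  where open ≡-Reasoning

laplacian-off : ∀ {n} (A : Adj n) {i j} → i ≢ j → laplacian A i j ≡ - + A i j
laplacian-off A {i} {j} i≢j =
  trans (cong (λ x → x * + valency A i - + A i j) (δ-≢ i≢j)) (ℤP.+-identityˡ (- + A i j))

laplacian-rowSum : ∀ {n} (A : Adj n) i → Σℤ n (laplacian A i) ≡ + 0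
laplacian-rowSum {n} A i = begin
  Σℤ n (λ j → δ i j * + valency A i - + A i j)                ≡⟨ Σℤ-distrib-+ n _ (λ j → - + A i j) ⟩
  Σℤ n (λ j → δ i j * + valency A i) + Σℤ n (λ j → - + A i j) ≡⟨ cong₂ _+_ (Σℤ-δˡ n i (λ _ → + valency A i)) (Σℤ-neg n (λ j → + A i j)) ⟩
  + valency A i - Σℤ n (λ j → + A i j)                        ≡⟨ cong (λ v → v - Σℤ n (λ j → + A i j)) valency≡Σ ⟩
  Σℤ n (λ j → + A i j) - Σℤ n (λ j → + A i j)                 ≡⟨ ℤP.+-inverseʳ (Σℤ n (λ j → + A i j)) ⟩
  + 0                                                         ∎
  where
  open ≡-Reasoning
  valency≡Σ : + valency A i ≡ Σℤ n (λ j → + A i j)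
  valency≡Σ = ℤP.0≤i⇒+∣i∣≡i (Σℤ-nonneg n (λ j → ℤ.+≤+ ℕ.z≤n))

laplacian-sym : ∀ {n} (A : Adj n) → (∀ i j → A i j ≡ A j i) → ∀ i j → laplacian A i j ≡ laplacian A j i
laplacian-sym A A-sym i j with i Fin.≟ j
... | yes refl = refl
... | no  i≢j  = trans (laplacian-off A i≢j) (trans (cong (-_ ∘ +_) (A-sym i j)) (sym (laplacian-off A (i≢j ∘ sym))))

laplacian-shift : ∀ {n} (A : Adj n) σ c a → (laplacian A ·ᵥ (λ j → σ j - c)) a ≡ (laplacian A ·ᵥ σ) a
laplacian-shift {n} A σ c a = begin
  Σℤ n (λ j → L a j * (σ j - c))                  ≡⟨ Σℤ-cong n (λ j → split (L a j) (σ j) c) ⟩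
  Σℤ n (λ j → L a j * σ j + - (L a j * c))        ≡⟨ Σℤ-distrib-+ n _ (λ j → - (L a j * c)) ⟩
  (L ·ᵥ σ) a + Σℤ n (λ j → - (L a j * c))         ≡⟨ cong (ℤ._+_ ((L ·ᵥ σ) a)) (Σℤ-neg n (λ j → L a j * c)) ⟩
  (L ·ᵥ σ) a - Σℤ n (λ j → L a j * c)             ≡⟨ cong (λ s → (L ·ᵥ σ) a - s) (*-distribʳ-Σℤ n c (L a)) ⟨
  (L ·ᵥ σ) a - Σℤ n (L a) * c                     ≡⟨ cong (λ s → (L ·ᵥ σ) a - s * c) (laplacian-rowSum A a) ⟩
  (L ·ᵥ σ) a - + 0 * c                            ≡⟨ ℤP.+-identityʳ ((L ·ᵥ σ) a) ⟩
  (L ·ᵥ σ) a                                      ∎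
  where
  open ≡-Reasoning
  L = laplacian A
  split : ∀ l x c → l * (x - c) ≡ l * x + - (l * c)
  split = solve-∀

laplacian-image-deg0 : ∀ {n} (A : Adj n) → (∀ i j → A i j ≡ A j i) → ∀ σ → IsDeg0 (laplacian A ·ᵥ σ)
laplacian-image-deg0 {n} A A-sym σ = begin
  Σℤ n (λ i → Σℤ n (λ j → L i j * σ j))  ≡⟨ Σℤ-comm n n (λ i j → L i j * σ j) ⟩
  Σℤ n (λ j → Σℤ n (λ i → L i j * σ j))  ≡⟨ Σℤ-cong n (λ j → *-distribʳ-Σℤ n (σ j) (λ i → L i j)) ⟨
  Σℤ n (λ j → Σℤ n (λ i → L i j) * σ j)  ≡⟨ Σℤ-zero n column≡0 ⟩
  + 0                                    ∎
  where
  open ≡-Reasoning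
  L = laplacian A
  column≡0 : ∀ j → Σℤ n (λ i → L i j) * σ j ≡ + 0
  column≡0 j = trans (cong (_* σ j) (trans (Σℤ-cong n (λ i → laplacian-sym A A-sym i j)) (laplacian-rowSum A j)))
                     (ℤP.*-zeroˡ (σ j))

laplacian-init : ∀ {k} (A : Adj (suc k)) σ → σ (fromℕ k) ≡ + 0 →
  ∀ a → (laplacian A ·ᵥ σ) (inject₁ a) ≡ (reducedLaplacian A ·ᵥ (σ ∘ inject₁)) a
laplacian-init {k} A σ σₙ≡0 a = begin
  Σℤ (suc k) (λ j → laplacian A (inject₁ a) j * σ j)
    ≡⟨ Σℤ-init-last k (λ j → laplacian A (inject₁ a) j * σ j) ⟩
  (reducedLaplacian A ·ᵥ (σ ∘ inject₁)) a + laplacian A (inject₁ a) (fromℕ k) * σ (fromℕ k)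
    ≡⟨ cong (λ s → (reducedLaplacian A ·ᵥ (σ ∘ inject₁)) a + laplacian A (inject₁ a) (fromℕ k) * s) σₙ≡0 ⟩
  (reducedLaplacian A ·ᵥ (σ ∘ inject₁)) a + laplacian A (inject₁ a) (fromℕ k) * + 0
    ≡⟨ cong (ℤ._+_ ((reducedLaplacian A ·ᵥ (σ ∘ inject₁)) a)) (ℤP.*-zeroʳ (laplacian A (inject₁ a) (fromℕ k))) ⟩
  (reducedLaplacian A ·ᵥ (σ ∘ inject₁)) a + + 0
    ≡⟨ ℤP.+-identityʳ _ ⟩
  (reducedLaplacian A ·ᵥ (σ ∘ inject₁)) a ∎
  where open ≡-Reasoning

principal⇔reducible : ∀ {k} (A : Adj (suc k)) → (∀ i j → A i j ≡ A j i) → ∀ {E} → IsDeg0 E →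
  IsPrincipal A E ⇔ (∃ λ τ → ∀ a → (reducedLaplacian A ·ᵥ τ) a ≡ reduce~ E a)
principal⇔reducible {k} A A-sym {E} E⁰ = mk⇔ to from
  where
  to : IsPrincipal A E → ∃ λ τ → ∀ a → (reducedLaplacian A ·ᵥ τ) a ≡ reduce~ E a
  to (σ , E≡Lσ) = (λ b → σ (inject₁ b) - σ (fromℕ k)) , λ a → sym (begin
    E (inject₁ a)                                           ≡⟨ E≡Lσ (inject₁ a) ⟩
    (laplacian A ·ᵥ σ) (inject₁ a)                          ≡⟨ laplacian-shift A σ (σ (fromℕ k)) (inject₁ a) ⟨
    (laplacian A ·ᵥ σ′) (inject₁ a)                         ≡⟨ laplacian-init A σ′ (ℤP.+-inverseʳ (σ (fromℕ k))) a ⟩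
    (reducedLaplacian A ·ᵥ (σ′ ∘ inject₁)) a                ∎)
    where
    open ≡-Reasoning
    σ′ : Divisor (suc k)
    σ′ j = σ j - σ (fromℕ k)
  from : (∃ λ τ → ∀ a → (reducedLaplacian A ·ᵥ τ) a ≡ reduce~ E a) → IsPrincipal A E
  from (τ , Mτ≡E) = τ ∷ʳ + 0 , deg0-agree-on-init E⁰ (laplacian-image-deg0 A A-sym (τ ∷ʳ + 0)) (λ a → sym (begin
    (laplacian A ·ᵥ (τ ∷ʳ + 0)) (inject₁ a)                       ≡⟨ laplacian-init A (τ ∷ʳ + 0) (∷ʳ-last τ (+ 0)) a ⟩
    (reducedLaplacian A ·ᵥ ((τ ∷ʳ + 0) ∘ inject₁)) a              ≡⟨ Σℤ-cong k (λ b → cong (reducedLaplacian A a b *_) (∷ʳ-init τ (+ 0) b)) ⟩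
    (reducedLaplacian A ·ᵥ τ) a                                   ≡⟨ Mτ≡E a ⟩
    E (inject₁ a)                                                 ∎))
    where open ≡-Reasoning

reducedLaplacian-sym : ∀ {k} (A : Adj (suc k)) → (∀ i j → A i j ≡ A j i) → IsSymmetric (reducedLaplacian A)
reducedLaplacian-sym A A-sym a b = laplacian-sym A A-sym (inject₁ a) (inject₁ b)

reducedLaplacian-off : ∀ {k} (A : Adj (suc k)) {a b} → a ≢ b →
  reducedLaplacian A a b ≡ - + A (inject₁ a) (inject₁ b)
reducedLaplacian-off A a≢b = laplacian-off A (a≢b ∘ FinP.inject₁-injective)

reducedLaplacian-rowSum : ∀ {k} (A : Adj (suc k)) a → rowSum (reducedLaplacian A) a ≡ + A (inject₁ a) (fromℕ k)
reducedLaplacian-rowSum {k} A a = ℤP.i-j≡0⇒i≡j _ _ (begin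
  rowSum (reducedLaplacian A) a - + A (inject₁ a) (fromℕ k)
    ≡⟨ cong (ℤ._+_ (rowSum (reducedLaplacian A) a)) (laplacian-off A (FinP.fromℕ≢inject₁ ∘ sym)) ⟨
  rowSum (reducedLaplacian A) a + laplacian A (inject₁ a) (fromℕ k)
    ≡⟨ Σℤ-init-last k (laplacian A (inject₁ a)) ⟨
  Σℤ (suc k) (laplacian A (inject₁ a))
    ≡⟨ laplacian-rowSum A (inject₁ a) ⟩
  + 0 ∎)
  where open ≡-Reasoning

reducedLaplacian-wcdd : ∀ {k} {A : Adj (suc k)} → IsConnectedLooplessMultigraph A →
  IsWeaklyChainedDominant (reducedLaplacian A)
reducedLaplacian-wcdd {k} {A} G = record
  { offDiagonal≤0 = λ a≢b → subst (_≤ + 0) (sym (reducedLaplacian-off A a≢b)) (ℤP.neg-mono-≤ (ℤ.+≤+ ℕ.z≤n))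
  ; rowSum≥0      = λ a → subst (+ 0 ≤_) (sym (reducedLaplacian-rowSum A a)) (ℤ.+≤+ ℕ.z≤n)
  ; chained       = λ a → chain (IsConnectedLooplessMultigraph.connected G (inject₁ a) (fromℕ k)) refl
  }
  where
  -- follow a path to the deleted vertex vₙ: the row of its last neighbour before vₙ is strictly dominant
  chain : ∀ {v} → Reachable A v (fromℕ k) → ∀ {a} → v ≡ inject₁ a → ChainToDominantRow (reducedLaplacian A) a
  chain here v≡a = ⊥-elim (FinP.fromℕ≢inject₁ v≡a)
  chain (step {j = j} 0<Avj path) {a} refl with initLastView j
  ... | last = dominant (subst (+ 0 <_) (sym (reducedLaplacian-rowSum A a)) (ℤ.+<+ 0<Avj))
  ... | init b with a Fin.≟ b
  ...   | yes refl = chain path refl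
  ...   | no  a≢b  = link (subst (_< + 0) (sym (reducedLaplacian-off A a≢b)) (ℤP.neg-mono-< (ℤ.+<+ 0<Avj)))
                          (chain path refl)

-- Residues, divisibility and gcds

gcdFold-∣ˡ : ∀ k g w → gcdFold k g w ℕ∣.∣ g
gcdFold-∣ˡ zero    g w = ℕ∣.∣-refl
gcdFold-∣ˡ (suc k) g w = ℕ∣.∣-trans (gcdFold-∣ˡ k (gcd g (w zero)) (w ∘ suc)) (gcd[m,n]∣m g (w zero))

gcdFold-∣ : ∀ k g w a → gcdFold k g w ℕ∣.∣ w a
gcdFold-∣ (suc k) g w zero    = ℕ∣.∣-trans (gcdFold-∣ˡ k (gcd g (w zero)) (w ∘ suc)) (gcd[m,n]∣n g (w zero))
gcdFold-∣ (suc k) g w (suc a) = gcdFold-∣ k (gcd g (w zero)) (w ∘ suc) a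

bézout-identity-in-ℤ : ∀ {d} a b c e → d ℕ.+ a ℕ.* b ≡ c ℕ.* e → + d ≡ + c * + e - + a * + b
bézout-identity-in-ℤ {d} a b c e eq = begin
  + d                               ≡⟨ cancel (+ d) (+ a * + b) ⟨
  + d + + a * + b - + a * + b       ≡⟨ cong (λ s → + d + s - + a * + b) (ℤP.pos-* a b) ⟨
  + d + + (a ℕ.* b) - + a * + b     ≡⟨ cong (_- + a * + b) (ℤP.pos-+ d (a ℕ.* b)) ⟨
  + (d ℕ.+ a ℕ.* b) - + a * + b     ≡⟨ cong (λ s → + s - + a * + b) eq ⟩
  + (c ℕ.* e) - + a * + b           ≡⟨ cong (_- + a * + b) (ℤP.pos-* c e) ⟩
  + c * + e - + a * + b             ∎
  where
  open ≡-Reasoning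
  cancel : ∀ x y → x + y - y ≡ x
  cancel = solve-∀

bézout : ∀ m n → ∃₂ λ p r → + gcd m n ≡ p * + m + r * + n
bézout m n with Bézout.identity (gcd-GCD m n)
... | Bézout.+- x y eq = + x , - + y , trans (bézout-identity-in-ℤ y n x m eq) (reorder (+ x) (+ m) (+ y) (+ n))
  where
  reorder : ∀ x m y n → x * m - y * n ≡ x * m + - y * n
  reorder = solve-∀
... | Bézout.-+ x y eq = - + x , + y , trans (bézout-identity-in-ℤ x m y n eq) (reorder (+ y) (+ n) (+ x) (+ m))
  where
  reorder : ∀ y n x m → y * n - x * m ≡ - x * m + y * n
  reorder = solve-∀

gcdFold-bézout : ∀ k g w → ∃₂ λ u (v : Fin k → ℤ) → + gcdFold k g w ≡ u * + g + Σℤ k (λ a → v a * + w a)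
gcdFold-bézout zero    g w = + 1 , (λ ()) , sym (trans (ℤP.+-identityʳ (+ 1 * + g)) (ℤP.*-identityˡ (+ g)))
gcdFold-bézout (suc k) g w with gcdFold-bézout k (gcd g (w zero)) (w ∘ suc) | bézout g (w zero)
... | u , v , eq | p , r , eq′ = u * p , v′ , (begin
  + gcdFold k (gcd g (w zero)) (w ∘ suc)              ≡⟨ eq ⟩
  u * + gcd g (w zero) + S                            ≡⟨ cong (λ x → u * x + S) eq′ ⟩
  u * (p * + g + r * + w zero) + S                    ≡⟨ regroup u p r (+ g) (+ w zero) S ⟩
  u * p * + g + (u * r * + w zero + S)                ∎)
  where
  open ≡-Reasoning
  S = Σℤ k (λ a → v a * + w (suc a))
  v′ : Fin (suc k) → ℤ
  v′ zero    = u * r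
  v′ (suc a) = v a
  regroup : ∀ u p r g x S → u * (p * g + r * x) + S ≡ u * p * g + (u * r * x + S)
  regroup = solve-∀

∣-Σℤ : ∀ k {x} {f : Fin k → ℤ} → (∀ a → x ∣ f a) → x ∣ Σℤ k f
∣-Σℤ zero    x∣f = divides (+ 0) refl
∣-Σℤ (suc k) x∣f = ∣m∣n⇒∣m+n (x∣f zero) (∣-Σℤ k (x∣f ∘ suc))

below-modulus-congruent⇒≡ : ∀ {m a b} → a ℕ.< m → b ℕ.< m → + m ∣ + a - + b → a ≡ b
below-modulus-congruent⇒≡ {m} {a} {b} a<m b<m m∣a-b =
  ℤP.+-injective (ℤP.i-j≡0⇒i≡j (+ a) (+ b) (trans (ℤP.m-n≡m⊖n a b) (ℤP.∣i∣≡0⇒i≡0 ∣a⊖b∣≡0)))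
  where
  ∣a⊖b∣<m : ℤ.∣ a ⊖ b ∣ ℕ.< m
  ∣a⊖b∣<m = ℕP.≤-<-trans (ℤP.∣m⊝n∣≤m⊔n a b) (ℕP.⊔-pres-<m a<m b<m)
  m∣∣a⊖b∣ : m ℕ∣.∣ ℤ.∣ a ⊖ b ∣
  m∣∣a⊖b∣ = ∣⇒∣ᵤ (subst (+ m ∣_) (ℤP.m-n≡m⊖n a b) m∣a-b)
  ∣a⊖b∣≡0 : ℤ.∣ a ⊖ b ∣ ≡ 0
  ∣a⊖b∣≡0 with ℤ.∣ a ⊖ b ∣ | ∣a⊖b∣<m | m∣∣a⊖b∣
  ... | zero  | _ | _   = refl
  ... | suc _ | n<m | m∣n = ⊥-elim (ℕ∣.>⇒∤ n<m m∣n)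

%ℕ-unique : ∀ r z m .{{_ : ℕ.NonZero m}} → r ℕ.< m → (+ r + z * + m) %ℕ m ≡ r
%ℕ-unique r z m r<m = below-modulus-congruent⇒≡ (n%ℕd<d S m) r<m (divides (z - S /ℕ m) (begin
  + (S %ℕ m) - + r                                      ≡⟨ add-sub (+ (S %ℕ m)) (S /ℕ m * + m) (+ r) ⟩
  + (S %ℕ m) + S /ℕ m * + m - S /ℕ m * + m - + r        ≡⟨ cong (λ x → x - S /ℕ m * + m - + r) (a≡a%ℕn+[a/ℕn]*n S m) ⟨
  S - S /ℕ m * + m - + r                                ≡⟨ collect (+ r) z (S /ℕ m) (+ m) ⟩
  (z - S /ℕ m) * + m                                    ∎))
  where
  open ≡-Reasoning
  S = + r + z * + m
  add-sub : ∀ x y r → x - r ≡ x + y - y - r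
  add-sub = solve-∀
  collect : ∀ r z q m → r + z * m - q * m - r ≡ (z - q) * m
  collect = solve-∀

gcdFold-nonZero : ∀ k m w → .{{ℕ.NonZero m}} → ℕ.NonZero (gcdFold k m w)
gcdFold-nonZero k m w = ℕ.≢-nonZero λ g≡0 →
  ℕ.≢-nonZero⁻¹ m (ℕ∣.0∣⇒≡0 (subst (ℕ∣._∣ m) g≡0 (gcdFold-∣ˡ k m w)))

∣-all⇔∣-gcdFold : ∀ k m w o → (∀ b → + m ∣ o * + w b) ⇔ (+ m ∣ o * + gcdFold k m w)
∣-all⇔∣-gcdFold k m w o = mk⇔ to from
  where
  g = gcdFold k m w
  to : (∀ b → + m ∣ o * + w b) → + m ∣ o * + g
  to m∣ow with gcdFold-bézout k m w
  ... | u , v , g≡ = subst (+ m ∣_) (sym o*g≡)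
    (∣m∣n⇒∣m+n (∣n⇒∣m*n (o * u) ∣-refl) (∣-Σℤ k (λ a → ∣n⇒∣m*n (v a) (m∣ow a))))
    where
    open ≡-Reasoning
    o*g≡ : o * + g ≡ o * u * + m + Σℤ k (λ a → v a * (o * + w a))
    o*g≡ = begin
      o * + g                                                  ≡⟨ cong (o *_) g≡ ⟩
      o * (u * + m + Σℤ k (λ a → v a * + w a))                 ≡⟨ ℤP.*-distribˡ-+ o (u * + m) _ ⟩
      o * (u * + m) + o * Σℤ k (λ a → v a * + w a)             ≡⟨ cong₂ _+_ (sym (ℤP.*-assoc o u (+ m))) (*-distribˡ-Σℤ k o _) ⟩
      o * u * + m + Σℤ k (λ a → o * (v a * + w a))             ≡⟨ cong (ℤ._+_ (o * u * + m)) (Σℤ-cong k (λ a → swap o (v a) (+ w a))) ⟩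
      o * u * + m + Σℤ k (λ a → v a * (o * + w a))             ∎
      where
      swap : ∀ o v w → o * (v * w) ≡ v * (o * w)
      swap = solve-∀
  from : + m ∣ o * + g → ∀ b → + m ∣ o * + w b
  from m∣og b = ∣-trans m∣og (*-monoʳ-∣ o (∣ᵤ⇒∣ (gcdFold-∣ k m w b)))

∣-*-cancel⇔ : ∀ {m q g} o .{{_ : ℕ.NonZero g}} → m ≡ q ℕ.* g → (+ m ∣ o * + g) ⇔ (+ q ∣ o)
∣-*-cancel⇔ {m} {q} {g} o m≡qg = mk⇔
  (λ m∣og → *-cancelʳ-∣ (+ g) (subst (_∣ o * + g) +m≡ m∣og))
  (λ q∣o → subst (_∣ o * + g) (sym +m≡) (*-monoˡ-∣ (+ g) q∣o))
  where
  +m≡ : + m ≡ + q * + g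
  +m≡ = trans (cong +_ m≡qg) (ℤP.pos-* q g)

residues⇔multiples : ∀ k m w q .{{_ : ℕ.NonZero m}} → m ≡ q ℕ.* gcdFold k m w → ∀ r →
  (∃ λ (x : Fin k → ℤ) → Σℤ k (λ a → + w a * x a) %ℕ m ≡ r) ⇔ (∃ λ t → t ℕ.< q × r ≡ t ℕ.* gcdFold k m w)
residues⇔multiples k m w q m≡qg r = mk⇔ to from
  where
  g = gcdFold k m w
  instance
    g≢0 : ℕ.NonZero g
    g≢0 = gcdFold-nonZero k m w
  to : (∃ λ (x : Fin k → ℤ) → Σℤ k (λ a → + w a * x a) %ℕ m ≡ r) → ∃ λ t → t ℕ.< q × r ≡ t ℕ.* g
  to (x , S%m≡r) = t , t<q , r≡tg
    where
    S = Σℤ k (λ a → + w a * x a)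
    g∣S : + g ∣ S
    g∣S = ∣-Σℤ k (λ a → ∣m⇒∣m*n {m = + w a} (x a) (∣ᵤ⇒∣ (gcdFold-∣ k m w a)))
    g∣r : g ℕ∣.∣ r
    g∣r = ∣⇒∣ᵤ (subst (λ s → + g ∣ + s) S%m≡r (∣m+n∣n⇒∣m (subst (+ g ∣_) (a≡a%ℕn+[a/ℕn]*n S m) g∣S)
                  (∣n⇒∣m*n (S /ℕ m) (∣ᵤ⇒∣ (gcdFold-∣ˡ k m w)))))
    t = ℕ∣._∣_.quotient g∣r
    r≡tg : r ≡ t ℕ.* g
    r≡tg = ℕ∣._∣_.equality g∣r
    t<q : t ℕ.< q
    t<q = ℕP.*-cancelʳ-< g t q (subst₂ ℕ._<_ (trans S%m≡r r≡tg) m≡qg (n%ℕd<d S m))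
  from : (∃ λ t → t ℕ.< q × r ≡ t ℕ.* g) → ∃ λ (x : Fin k → ℤ) → Σℤ k (λ a → + w a * x a) %ℕ m ≡ r
  from (t , t<q , r≡tg) with gcdFold-bézout k m w
  ... | u , v , g≡ = (λ a → + t * v a) , (begin
    Σℤ k (λ a → + w a * (+ t * v a)) %ℕ m        ≡⟨ cong (_%ℕ m) S≡ ⟩
    (+ (t ℕ.* g) + - (+ t * u) * + m) %ℕ m       ≡⟨ %ℕ-unique (t ℕ.* g) (- (+ t * u)) m tg<m ⟩
    t ℕ.* g                                      ≡⟨ r≡tg ⟨
    r                                            ∎)
    where
    open ≡-Reasoning
    tg<m : t ℕ.* g ℕ.< m
    tg<m = subst (t ℕ.* g ℕ.<_) (sym m≡qg) (ℕP.*-monoˡ-< g t<q)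
    S≡ : Σℤ k (λ a → + w a * (+ t * v a)) ≡ + (t ℕ.* g) + - (+ t * u) * + m
    S≡ = begin
      Σℤ k (λ a → + w a * (+ t * v a))           ≡⟨ Σℤ-cong k (λ a → swap (+ w a) (+ t) (v a)) ⟩
      Σℤ k (λ a → + t * (v a * + w a))           ≡⟨ *-distribˡ-Σℤ k (+ t) (λ a → v a * + w a) ⟨
      + t * Σℤ k (λ a → v a * + w a)             ≡⟨ cong (+ t *_) (isolate (+ g) (u * + m) _ g≡) ⟩
      + t * (+ g - u * + m)                      ≡⟨ expand (+ t) (+ g) u (+ m) ⟩
      + t * + g + - (+ t * u) * + m              ≡⟨ cong (_+ - (+ t * u) * + m) (ℤP.pos-* t g) ⟨
      + (t ℕ.* g) + - (+ t * u) * + m            ∎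
      where
      swap : ∀ w t v → w * (t * v) ≡ t * (v * w)
      swap = solve-∀
      expand : ∀ t g u m → t * (g - u * m) ≡ t * g + - (t * u) * m
      expand = solve-∀
      isolate : ∀ g x y → g ≡ x + y → y ≡ g - x
      isolate g x y g≡x+y = trans (sym (cancel x y)) (cong (_- x) (sym g≡x+y))
        where
        cancel : ∀ x y → x + y - x ≡ y
        cancel = solve-∀

∣-*-%ℕ⇔ : ∀ m .{{_ : ℕ.NonZero m}} o x → (+ m ∣ o * x) ⇔ (+ m ∣ o * + (x %ℕ m))
∣-*-%ℕ⇔ m o x = mk⇔
  (λ m∣ox → ∣m+n∣n⇒∣m (subst (+ m ∣_) o*x≡ m∣ox) m∣multiple)
  (λ m∣or → subst (+ m ∣_) (sym o*x≡) (∣m∣n⇒∣m+n m∣or m∣multiple))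
  where
  m∣multiple : + m ∣ o * (x /ℕ m) * + m
  m∣multiple = ∣n⇒∣m*n (o * (x /ℕ m)) ∣-refl
  o*x≡ : o * x ≡ o * + (x %ℕ m) + o * (x /ℕ m) * + m
  o*x≡ = trans (cong (o *_) (a≡a%ℕn+[a/ℕn]*n x m)) (distrib o (+ (x %ℕ m)) (x /ℕ m) (+ m))
    where
    distrib : ∀ o r q m → o * (r + q * m) ≡ o * r + o * q * m
    distrib = solve-∀

multiples-below : ∀ q g .{{_ : ℕ.NonZero g}} → ∃ λ (xs : List ℕ) →
  Unique xs × (∀ r → (r ∈ xs) ⇔ (∃ λ t → t ℕ.< q × r ≡ t ℕ.* g)) × length xs ≡ q
multiples-below q g = map (ℕ._* g) (upTo q)
  , Unique.map⁺ (ℕP.*-cancelʳ-≡ _ _ g) (Unique.upTo⁺ q)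
  , (λ r → mk⇔ to from)
  , trans (length-map (ℕ._* g) (upTo q)) (length-upTo q)
  where
  to : ∀ {r} → r ∈ map (ℕ._* g) (upTo q) → ∃ λ t → t ℕ.< q × r ≡ t ℕ.* g
  to r∈ with t , t∈ , r≡tg ← ∈-map⁻ (ℕ._* g) r∈ = t , ∈-upTo⁻ t∈ , r≡tg
  from : ∀ {r} → (∃ λ t → t ℕ.< q × r ≡ t ℕ.* g) → r ∈ map (ℕ._* g) (upTo q)
  from (t , t<q , refl) = ∈-map⁺ (ℕ._* g) (∈-upTo⁺ t<q)

-- The order of [D] and the image of φ

module ⇔-Reasoning = Relation.Binary.Reasoning.Setoid (⇔-setoid 0ℓ)

modN≡%ℕ : ∀ x m .{{_ : ℕ.NonZero m}} → x modN m ≡ x %ℕ m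
modN≡%ℕ x (suc m) = refl

divN≡/ : ∀ a b .{{_ : ℕ.NonZero b}} → a divN b ≡ a ℕ./ b
divN≡/ a (suc b) = refl

∣⇔abs∣ : ∀ d x → (d ∣ x) ⇔ (+ ℤ.∣ d ∣ ∣ x)
∣⇔abs∣ d x = mk⇔ (∣-trans ∣m∣∣m) (∣-trans m∣∣m∣)

•-deg0 : ∀ {n} o {D : Divisor n} → IsDeg0 D → IsDeg0 (o • D)
•-deg0 {n} o {D} D⁰ = trans (sym (*-distribˡ-Σℤ n (+ o) D)) (trans (cong (+ o *_) D⁰) (ℤP.*-zeroʳ (+ o)))

·ᵥ-scale : ∀ {k} (C : Matrix k) c x b → (C ·ᵥ (λ a → c * x a)) b ≡ c * (C ·ᵥ x) b
·ᵥ-scale {k} C c x b = trans (Σℤ-cong k (λ a → swap (C b a) c (x a))) (sym (*-distribˡ-Σℤ k c (λ a → C b a * x a)))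
  where
  swap : ∀ m c x → m * (c * x) ≡ c * (m * x)
  swap = solve-∀

jacOrder-nonZero : ∀ {k} {A : Adj (suc k)} → IsConnectedLooplessMultigraph A → ℕ.NonZero (jacOrder A)
jacOrder-nonZero {k} {A} G = ℕ.≢-nonZero
  (det≢0 k (reducedLaplacian-sym A (IsConnectedLooplessMultigraph.symmetric G)) (reducedLaplacian-wcdd G)
   ∘ ℤP.∣i∣≡0⇒i≡0)

principal⇔jacOrder∣ : ∀ {k} {A : Adj (suc k)} → IsConnectedLooplessMultigraph A →
  ∀ {D} → IsDeg0 D → ∀ o → IsPrincipal A (o • D) ⇔ (∀ b → + jacOrder A ∣ + o * + wVec A D b)
principal⇔jacOrder∣ {k} {A} G {D} D⁰ o = begin
  IsPrincipal A (o • D)                                       ≈⟨ principal⇔reducible A A-sym (•-deg0 o {D} D⁰) ⟩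
  (∃ λ τ → ∀ a → (M ·ᵥ τ) a ≡ reduce~ (o • D) a)              ≈⟨ solvable⇔det∣adj k M M-sym (reducedLaplacian-wcdd G) _ ⟩
  (∀ b → det k M ∣ (adj k M ·ᵥ reduce~ (o • D)) b)            ≈⟨ pointwise ⟩
  (∀ b → + m ∣ + o * + wVec A D b)                            ∎
  where
  open ⇔-Reasoning
  instance
    m≢0 : ℕ.NonZero (jacOrder A)
    m≢0 = jacOrder-nonZero G
  A-sym = IsConnectedLooplessMultigraph.symmetric G
  M = reducedLaplacian A
  M-sym = reducedLaplacian-sym A A-sym
  m = jacOrder A
  w′ = cofactorL A ·ᵥ reduce~ D
  each : ∀ b → (det k M ∣ (adj k M ·ᵥ reduce~ (o • D)) b) ⇔ (+ m ∣ + o * + wVec A D b)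
  each b = begin
    (det k M ∣ (adj k M ·ᵥ reduce~ (o • D)) b)  ≡⟨ cong (det k M ∣_) (·ᵥ-scale (adj k M) (+ o) (reduce~ D) b) ⟩
    (det k M ∣ + o * w′ b)                      ≈⟨ ∣⇔abs∣ (det k M) (+ o * w′ b) ⟩
    (+ m ∣ + o * w′ b)                          ≈⟨ ∣-*-%ℕ⇔ m (+ o) (w′ b) ⟩
    (+ m ∣ + o * + (w′ b %ℕ m))                 ≡⟨ cong (λ r → + m ∣ + o * + r) (modN≡%ℕ (w′ b) m) ⟨
    (+ m ∣ + o * + wVec A D b)                  ∎
  pointwise : (∀ b → det k M ∣ (adj k M ·ᵥ reduce~ (o • D)) b) ⇔ (∀ b → + m ∣ + o * + wVec A D b)
  pointwise = mk⇔ (λ h b → Equivalence.to (each b) (h b)) (λ h b → Equivalence.from (each b) (h b))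

image⇔residues : ∀ {k} (A : Adj (suc k)) .{{_ : ℕ.NonZero (jacOrder A)}} D r →
  InImagePhi A D r ⇔ (∃ λ (x : Fin k → ℤ) → Σℤ k (λ a → + wVec A D a * x a) %ℕ jacOrder A ≡ r)
image⇔residues {k} A D r = mk⇔ to from
  where
  m = jacOrder A
  S : (Fin k → ℤ) → ℤ
  S x = Σℤ k (λ a → + wVec A D a * x a)
  to : InImagePhi A D r → ∃ λ x → S x %ℕ m ≡ r
  to (D′ , _ , φ≡r) = reduce~ D′ , trans (sym (modN≡%ℕ (S (reduce~ D′)) m)) φ≡r
  from : (∃ λ x → S x %ℕ m ≡ r) → InImagePhi A D r
  from (x , Sx%m≡r) = x ∷ʳ - Σℤ k x , ∷ʳ-neg-sum-deg0 x , (begin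
    phi A D (x ∷ʳ - Σℤ k x)              ≡⟨ modN≡%ℕ (S (reduce~ (x ∷ʳ - Σℤ k x))) m ⟩
    S (reduce~ (x ∷ʳ - Σℤ k x)) %ℕ m     ≡⟨ cong (_%ℕ m) (Σℤ-cong k (λ a → cong (+ wVec A D a *_) (∷ʳ-init x _ a))) ⟩
    S x %ℕ m                             ≡⟨ Sx%m≡r ⟩
    r                                    ∎)
    where open ≡-Reasoning

order-and-image : ∀ {k} {A : Adj (suc k)} → IsConnectedLooplessMultigraph A → ∀ {D} → IsDeg0 D →
  ∀ q → jacOrder A ≡ q ℕ.* gcdMW A D → IsOrderInJac A D q × ImageCard A D q
order-and-image {k} {A} G {D} D⁰ q m≡qg = (0<q , Equivalence.from (principal⇔q∣ q) ∣-refl , minimal) , image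
  where
  m = jacOrder A
  g = gcdMW A D
  instance
    m≢0 : ℕ.NonZero m
    m≢0 = jacOrder-nonZero G
    g≢0 : ℕ.NonZero g
    g≢0 = gcdFold-nonZero k m (wVec A D)
  principal⇔q∣ : ∀ o → IsPrincipal A (o • D) ⇔ (+ q ∣ + o)
  principal⇔q∣ o = begin
    IsPrincipal A (o • D)                 ≈⟨ principal⇔jacOrder∣ G D⁰ o ⟩
    (∀ b → + m ∣ + o * + wVec A D b)      ≈⟨ ∣-all⇔∣-gcdFold k m (wVec A D) (+ o) ⟩
    (+ m ∣ + o * + g)                     ≈⟨ ∣-*-cancel⇔ (+ o) m≡qg ⟩
    (+ q ∣ + o)                           ∎
    where open ⇔-Reasoning
  0<q : 0 ℕ.< q
  0<q = ℕ.>-nonZero⁻¹ q {{ℕ.≢-nonZero λ q≡0 → ℕ.≢-nonZero⁻¹ m (trans m≡qg (cong (ℕ._* g) q≡0))}}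
  minimal : ∀ o → 0 ℕ.< o → IsPrincipal A (o • D) → q ℕ.≤ o
  minimal o 0<o principal = ℕ∣.∣⇒≤ {{ℕ.>-nonZero 0<o}} (∣⇒∣ᵤ (Equivalence.to (principal⇔q∣ o) principal))
  image : ImageCard A D q
  image with multiples-below q g
  ... | xs , unique , ∈xs⇔ , length≡q = xs , unique , (λ r → begin
    (r ∈ xs)                                                 ≈⟨ ∈xs⇔ r ⟩
    (∃ λ t → t ℕ.< q × r ≡ t ℕ.* g)                          ≈⟨ ⇔-sym (residues⇔multiples k m (wVec A D) q m≡qg r) ⟩
    (∃ λ x → Σℤ k (λ a → + wVec A D a * x a) %ℕ m ≡ r)       ≈⟨ ⇔-sym (image⇔residues A D r) ⟩
    InImagePhi A D r                                         ∎) , length≡q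
    where open ⇔-Reasoning

lemma3p1 : (k : ℕ) (A : Adj (suc k)) → IsConnectedLooplessMultigraph A →
    (D : Divisor (suc k)) → IsDeg0 D →
    IsOrderInJac A D (jacOrder A divN gcdMW A D) ×
      ImageCard A D (jacOrder A divN gcdMW A D)
lemma3p1 k A G D D⁰ =
  subst (λ o → IsOrderInJac A D o × ImageCard A D o) (sym m/g≡q) (order-and-image G D⁰ q m≡qg)
  where
  instance
    g≢0 : ℕ.NonZero (gcdMW A D)
    g≢0 = gcdFold-nonZero k (jacOrder A) (wVec A D) {{jacOrder-nonZero G}}
  g∣m : gcdMW A D ℕ∣.∣ jacOrder A
  g∣m = gcdFold-∣ˡ k (jacOrder A) (wVec A D)
  q : ℕ
  q = ℕ∣._∣_.quotient g∣m
  m≡qg : jacOrder A ≡ q ℕ.* gcdMW A D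
  m≡qg = ℕ∣._∣_.equality g∣m
  m/g≡q : jacOrder A divN gcdMW A D ≡ q
  m/g≡q = begin
    jacOrder A divN gcdMW A D        ≡⟨ divN≡/ (jacOrder A) (gcdMW A D) ⟩
    jacOrder A ℕ./ gcdMW A D         ≡⟨ cong (ℕ._/ gcdMW A D) m≡qg ⟩
    q ℕ.* gcdMW A D ℕ./ gcdMW A D    ≡⟨ m*n/n≡m q (gcdMW A D) ⟩
    q                                ∎
    where open ≡-Reasoning
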